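{- Let $G$ be a graph with $t$ vertices, $m$ edges and maximum degree $\Delta$, let $w$ be a positive integer, and let $0<p<1$. Set $q=1-p^2(1-p)^w$ and $$D=m\binom{t-2}{w}-\bigl(m-(w+2)\Delta\bigr)\binom{t-w-4}{w}.$$ Then $$N(G,w;1)\leq\left\lceil\frac{\log_2\bigl(e(D+1)\bigr)}{ -\log_2 q}\right\rceil.$$
   Context: For a graph $G$, a collection $\{A_1,\ldots,A_n\}$ of subsets of $V(G)$ is a $(w,d)$-covering of $G$ if for every edge $\{u,v\}$ and every $w$-subset $W\subseteq V(G)$ disjoint from $\{u,v\}$ there are at least $d$ sets $A_j$ with $\{u,v\}\subseteq A_j$ and $W\cap A_j=\emptyset$; $N(G,w;d)$ is the minimum size of a $(w,d)$-covering of $G$. Here $e$ is Euler's number.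
   Formalization: The parameter p with $0<p<1$ ranges over the rationals. -}

module Defs where

open import Data.Nat as ℕ using (ℕ; zero; suc; _≤_; _<ᵇ_; _⊔_; _!)
open import Data.Nat.Properties using (_!≢0)
open import Data.Nat.Combinatorics using (_C_)
open import Data.Integer as ℤ using (ℤ; +_)
open import Data.Rational as ℚ using (ℚ; 0ℚ; 1ℚ)
open import Data.Fin using (Fin; toℕ)
open import Data.Fin.Subset using (Subset; _∈_; _∉_; ∣_∣; _∩_; inside; outside)
open import Data.Vec using (tabulate)
open import Data.List using (List; map; allFin; foldr)
open import Data.Nat.ListAction using (sum)
open import Data.Product using (Σ; _×_; ∃-syntax)
open import Data.Bool using (if_then_else_)
open import Relation.Binary.PropositionalEquality using (_≡_)
open import Relation.Nullary using (¬_)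

record Graph (t : ℕ) : Set where
  field
    nbr       : Fin t → Subset t
    symmetric : ∀ {u v} → v ∈ nbr u → u ∈ nbr v
    irrefl    : ∀ {u} → u ∉ nbr u

open Graph public

Adj : ∀ {t} → Graph t → Fin t → Fin t → Set
Adj G u v = v ∈ nbr G u

degree : ∀ {t} → Graph t → Fin t → ℕ
degree G u = ∣ nbr G u ∣

maxDegree : ∀ {t} → Graph t → ℕ
maxDegree {t} G = foldr _⊔_ 0 (map (degree G) (allFin t))

above : ∀ {t} → Fin t → Subset t
above i = tabulate (λ j → if toℕ i <ᵇ toℕ j then inside else outside)

edgeCount : ∀ {t} → Graph t → ℕ
edgeCount {t} G = sum (map (λ i → ∣ nbr G i ∩ above i ∣) (allFin t))

IsCovering : ∀ {t n} → Graph t → ℕ → ℕ → (Fin n → Subset t) → Set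
IsCovering {t} {n} G w d A =
  ∀ (u v : Fin t) → Adj G u v →
  ∀ (W : Subset t) → ∣ W ∣ ≡ w → u ∉ W → v ∉ W →
  Σ (Subset n) λ J → d ≤ ∣ J ∣ ×
    (∀ j → j ∈ J → (u ∈ A j) × (v ∈ A j) × (∀ x → x ∈ W → x ∉ A j))

-- N(G,w;d) ≤ n : some (w,d)-covering of G has at most n sets
N≤ : ∀ {t} → Graph t → ℕ → ℕ → ℕ → Set
N≤ {t} G w d n = ∃[ k ] (k ≤ n × Σ (Fin k → Subset t) (IsCovering G w d))

_^ℚ_ : ℚ → ℕ → ℚ
x ^ℚ zero  = 1ℚ
x ^ℚ suc k = x ℚ.* (x ^ℚ k)

ℕtoℚ : ℕ → ℚ
ℕtoℚ n = (+ n) ℚ./ 1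

ℤtoℚ : ℤ → ℚ
ℤtoℚ z = z ℚ./ 1

eSum : ℕ → ℚ
eSum zero    = 1ℚ
eSum (suc k) = eSum k ℚ.+ ((+ 1) ℚ./ (suc k !)) {{suc k !≢0}}

-- e · x ≤ 1 (for x ≥ 0), expressed through e = sup_k eSum k
e*_≤1 : ℚ → Set
e* x ≤1 = ∀ k → eSum k ℚ.* x ℚ.≤ 1ℚ

qOf : ℚ → ℕ → ℚ
qOf p w = 1ℚ ℚ.- (p ℚ.* p) ℚ.* ((1ℚ ℚ.- p) ^ℚ w)

-- D = m C(t-2,w) - (m - (w+2)Δ) C(t-w-4,w)   (computed in ℤ;
-- binomials C(a,w) with a < 0 are 0, matching ℕ-truncated ∸ since w ≥ 1)
DOf : ℕ → ℕ → ℕ → ℕ → ℤ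
DOf t m Δ w =
  (+ m) ℤ.* (+ ((t ℕ.∸ 2) C w))
  ℤ.- ((+ m) ℤ.- (+ ((w ℕ.+ 2) ℕ.* Δ))) ℤ.* (+ ((t ℕ.∸ (w ℕ.+ 4)) C w))

-- Put each vertex x into the j-th set (j < n) independently with probability p = a/b, by colouring
-- the coordinates (j, x) uniformly with b colours and keeping the colours below a. For an edge
-- {u, v} and a w-set W missing it, the bad event "no set contains u and v and misses W" has
-- probability q^n and depends only on the colours of the w + 2 vertices of W ∪ {u, v}. At most
-- (w + 2)Δ edges meet such a vertex set, so of the m C(t-2, w) bad events at least
-- (m - (w + 2)Δ) C(t-w-4, w) have a disjoint vertex set: every event depends on at most D events,
-- itself included. Since (1 + 1/D)^D ≤ e, the hypothesis gives (D + 1)^(D + 1) q^n ≤ D^D, and the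
-- symmetric Lovász Local Lemma, proved by the usual induction on the conditioning set, yields an
-- outcome avoiding every bad event, that is, a (w,1)-covering by n sets. Probabilities are
-- represented by numbers of outcomes, so everything except the comparison with e is arithmetic in ℕ.

module Submission where

open import Data.Nat using (ℕ; NonZero; suc)
open import Defs

module Counting where
  open import Data.Nat using (ℕ; zero; suc; _+_; _*_; _^_; _≤_; _<_; z≤n; s≤s)
  open import Data.Nat.Properties
  open import Data.Nat.Tactic.RingSolver using (solve)
  open import Data.Bool using (Bool; true; false; _∧_; _∨_; not; if_then_else_)
  open import Data.Bool.Properties using (∨-zeroʳ; ∨-identityʳ; ∧-zeroʳ; ∧-identityʳ)
  open import Data.Fin using (Fin; zero; suc)
  open import Data.List using (List; []; _∷_; _++_; map; filterᵇ; cartesianProduct; allFin; tabulate) renaming (lookup to lookupᴸ)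
  open import Data.Product using (∃; _×_; _,_)
  open import Data.Empty using (⊥-elim)
  open import Function using (_∘_; id)
  open import Relation.Binary.PropositionalEquality
  open import Algebra.Properties.CommutativeSemigroup *-commutativeSemigroup using (x∙yz≈y∙xz)

  open import Algebra.Properties.Semiring.Sum +-*-semiring public
    using (sum; sum-cong-≗; ∑-distrib-+; ∑-comm; *-distribˡ-sum; *-distribʳ-sum; sum-init-last)

  𝟙 : Bool → ℕ
  𝟙 true  = 1
  𝟙 false = 0

  𝟙-∧ : ∀ x y → 𝟙 (x ∧ y) ≡ 𝟙 x * 𝟙 y
  𝟙-∧ true  y = sym (+-identityʳ (𝟙 y))
  𝟙-∧ false y = refl

  𝟙-mono : ∀ {x y} → (x ≡ true → y ≡ true) → 𝟙 x ≤ 𝟙 y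
  𝟙-mono {true}  x⇒y rewrite x⇒y refl = ≤-refl
  𝟙-mono {false} _   = z≤n

  sum-const : ∀ n k → sum {n} (λ _ → k) ≡ n * k
  sum-const zero    k = refl
  sum-const (suc n) k = cong (k +_) (sum-const n k)

  sum-mono-≤ : ∀ {n} {f g : Fin n → ℕ} → (∀ i → f i ≤ g i) → sum f ≤ sum g
  sum-mono-≤ {zero}  f≤g = z≤n
  sum-mono-≤ {suc n} f≤g = +-mono-≤ (f≤g zero) (sum-mono-≤ (f≤g ∘ suc))

  sum-pos⇒∃ : ∀ {n} (f : Fin n → ℕ) → 0 < sum f → ∃ λ i → 0 < f i
  sum-pos⇒∃ {suc n} f pos with f zero in f₀
  ... | suc _ = zero , subst (0 <_) (sym f₀) (s≤s z≤n)
  ... | zero  with sum-pos⇒∃ (f ∘ suc) pos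
  ...   | i , fi = suc i , fi

  *-∑-const-factor : ∀ {n} (f g : Fin n → ℕ) → (∀ i j → g i ≡ g j) →
    n * sum (λ i → f i * g i) ≡ sum f * sum g
  *-∑-const-factor {zero}  f g _ = refl
  *-∑-const-factor {suc n} f g g-const = begin
    suc n * sum (λ i → f i * g i)  ≡⟨ cong (suc n *_) (sum-cong-≗ (λ i → cong (f i *_) (g-const i zero))) ⟩
    suc n * sum (λ i → f i * g₀)   ≡⟨ cong (suc n *_) (sym (*-distribʳ-sum g₀ f)) ⟩
    suc n * (sum f * g₀)           ≡⟨ x∙yz≈y∙xz (suc n) (sum f) g₀ ⟩
    sum f * (suc n * g₀)           ≡⟨ cong (sum f *_) (sym (trans (sum-cong-≗ (λ i → g-const i zero)) (sum-const (suc n) g₀))) ⟩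
    sum f * sum g                  ∎
    where
    open ≡-Reasoning
    g₀ = g zero

  count : ∀ {n} → (Fin n → Bool) → ℕ
  count S = sum (𝟙 ∘ S)

  _==_ : ∀ {n} → Fin n → Fin n → Bool
  zero  == zero  = true
  zero  == suc _ = false
  suc _ == zero  = false
  suc i == suc j = i == j

  ==-refl : ∀ {n} (i : Fin n) → (i == i) ≡ true
  ==-refl zero    = refl
  ==-refl (suc i) = ==-refl i

  ==⇒≡ : ∀ {n} {i j : Fin n} → (i == j) ≡ true → i ≡ j
  ==⇒≡ {i = zero}  {zero}  _  = refl
  ==⇒≡ {i = suc i} {suc j} eq = cong suc (==⇒≡ eq)

  ≢⇒==false : ∀ {n} {i j : Fin n} → i ≢ j → (i == j) ≡ false
  ≢⇒==false {i = i} {j} i≢j with i == j in eq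
  ... | true  = ⊥-elim (i≢j (==⇒≡ eq))
  ... | false = refl

  count-cong : ∀ {n} {S T : Fin n → Bool} → (∀ i → S i ≡ T i) → count S ≡ count T
  count-cong S≗T = sum-cong-≗ (cong 𝟙 ∘ S≗T)

  count-true : ∀ n → count {n} (λ _ → true) ≡ n
  count-true n = trans (sum-const n 1) (*-identityʳ n)

  count-mono : ∀ {n} {S T : Fin n → Bool} → (∀ i → S i ≡ true → T i ≡ true) → count S ≤ count T
  count-mono S⊆T = sum-mono-≤ (λ i → 𝟙-mono (S⊆T i))

  count≤n : ∀ {n} (S : Fin n → Bool) → count S ≤ n
  count≤n {n} S = ≤-trans (count-mono {n} {S} {λ _ → true} (λ _ _ → refl)) (≤-reflexive (count-true n))

  count-false : ∀ n → count {n} (λ _ → false) ≡ 0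
  count-false n = trans (sum-const n 0) (*-zeroʳ n)

  count-∨ : ∀ {n} (S T : Fin n → Bool) → count (λ i → S i ∨ T i) ≤ count S + count T
  count-∨ {n} S T = ≤-trans (sum-mono-≤ (λ i → 𝟙-∨ (S i) (T i))) (≤-reflexive (∑-distrib-+ {n} (𝟙 ∘ S) (𝟙 ∘ T)))
    where
    𝟙-∨ : ∀ x y → 𝟙 (x ∨ y) ≤ 𝟙 x + 𝟙 y
    𝟙-∨ true  y = s≤s z≤n
    𝟙-∨ false y = ≤-refl

  count-split : ∀ {n} (S D : Fin n → Bool) →
    count S ≡ count (λ i → S i ∧ not (D i)) + count (λ i → S i ∧ D i)
  count-split {n} S D = trans (sum-cong-≗ (λ i → 𝟙-split (S i) (D i))) (∑-distrib-+ {n} _ _)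
    where
    𝟙-split : ∀ x y → 𝟙 x ≡ 𝟙 (x ∧ not y) + 𝟙 (x ∧ y)
    𝟙-split true  true  = refl
    𝟙-split true  false = refl
    𝟙-split false y     = refl

  count≡0⇒false : ∀ {n} (S : Fin n → Bool) → count S ≡ 0 → ∀ i → S i ≡ false
  count≡0⇒false {suc n} S count≡0 zero    = 𝟙≡0 (m+n≡0⇒m≡0 (𝟙 (S zero)) count≡0)
    where
    𝟙≡0 : ∀ {x} → 𝟙 x ≡ 0 → x ≡ false
    𝟙≡0 {false} _ = refl
  count≡0⇒false {suc n} S count≡0 (suc i) = count≡0⇒false (S ∘ suc) (m+n≡0⇒n≡0 (𝟙 (S zero)) count≡0) i

  count-pos⇒∃ : ∀ {n} (S : Fin n → Bool) → 0 < count S → ∃ λ i → S i ≡ true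
  count-pos⇒∃ S pos with sum-pos⇒∃ (𝟙 ∘ S) pos
  ... | i , 𝟙Si>0 = i , 𝟙-pos 𝟙Si>0
    where
    𝟙-pos : ∀ {x} → 0 < 𝟙 x → x ≡ true
    𝟙-pos {true} _ = refl

  count-== : ∀ {n} (i : Fin n) → count (i ==_) ≡ 1
  count-== {suc n} zero    = cong suc (count-false n)
  count-== {suc n} (suc i) = count-== i

  count-remove : ∀ {n} (R : Fin n → Bool) {j} → R j ≡ true →
    count R ≡ suc (count (λ k → R k ∧ not (j == k)))
  count-remove {n} R {j} Rj = begin
    count R                                                   ≡⟨ sum-cong-≗ split ⟩
    sum (λ k → 𝟙 (j == k) + 𝟙 (R k ∧ not (j == k)))          ≡⟨ ∑-distrib-+ {n} _ _ ⟩
    count (j ==_) + count (λ k → R k ∧ not (j == k))          ≡⟨ cong (_+ count (λ k → R k ∧ not (j == k))) (count-== j) ⟩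
    suc (count (λ k → R k ∧ not (j == k)))                    ∎
    where
    open ≡-Reasoning
    split : ∀ k → 𝟙 (R k) ≡ 𝟙 (j == k) + 𝟙 (R k ∧ not (j == k))
    split k with j == k in j==k
    ... | true with refl ← ==⇒≡ {i = j} {k} j==k rewrite Rj = refl
    ... | false with R k
    ...   | true  = refl
    ...   | false = refl

  ∈⇒1≤count : ∀ {n} (S : Fin n → Bool) {i} → S i ≡ true → 1 ≤ count S
  ∈⇒1≤count {n} S {i} i∈S = begin
    1               ≡⟨ count-== i ⟨
    count (i ==_)   ≤⟨ count-mono {n} {i ==_} {S} (λ k i==k → subst (λ k → S k ≡ true) (==⇒≡ i==k) i∈S) ⟩
    count S         ∎
    where open ≤-Reasoning

  count-insert : ∀ {n} (S : Fin n → Bool) {j} → S j ≡ false →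
    count (λ k → S k ∨ (j == k)) ≡ suc (count S)
  count-insert {n} S {j} Sj = trans (count-remove (λ k → S k ∨ (j == k)) j∈S∪j) (cong suc (count-cong {n} removed))
    where
    j∈S∪j : (S j ∨ (j == j)) ≡ true
    j∈S∪j = trans (cong (S j ∨_) (==-refl j)) (∨-zeroʳ (S j))
    removed : ∀ k → ((S k ∨ (j == k)) ∧ not (j == k)) ≡ S k
    removed k with j == k in j==k
    ... | true  = trans (∧-zeroʳ _) (sym (subst (λ x → S x ≡ false) (==⇒≡ j==k) Sj))
    ... | false = trans (∧-identityʳ _) (∨-identityʳ _)

  remove-insert : ∀ {n} (U R : Fin n → Bool) {j} → R j ≡ true →
    ∀ k → ((U k ∨ (R k ∧ not (j == k))) ∨ (j == k)) ≡ (U k ∨ R k)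
  remove-insert U R {j} Rj k with j == k in j==k
  ... | true  with refl ← ==⇒≡ {i = j} {k} j==k rewrite Rj = trans (∨-zeroʳ _) (sym (∨-zeroʳ (U j)))
  ... | false = trans (∨-identityʳ _) (cong (U k ∨_) (∧-identityʳ (R k)))

  every : ∀ {n} → (Fin n → Bool) → Bool
  every {zero}  f = true
  every {suc n} f = f zero ∧ every (f ∘ suc)

  every-cong : ∀ {n} {f g : Fin n → Bool} → (∀ i → f i ≡ g i) → every f ≡ every g
  every-cong {zero}  f≗g = refl
  every-cong {suc n} f≗g = cong₂ _∧_ (f≗g zero) (every-cong (f≗g ∘ suc))

  every⇒ : ∀ {n} {f : Fin n → Bool} → every f ≡ true → ∀ i → f i ≡ true
  every⇒ {suc n} {f} all zero    with f zero
  ... | true = refl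
  every⇒ {suc n} {f} all (suc i) with f zero
  ... | true = every⇒ all i

  ⇒every : ∀ {n} {f : Fin n → Bool} → (∀ i → f i ≡ true) → every f ≡ true
  ⇒every {zero}  all = refl
  ⇒every {suc n} all rewrite all zero = ⇒every (all ∘ suc)

  ¬every⇒∃ : ∀ {n} {f : Fin n → Bool} → every f ≡ false → ∃ λ i → f i ≡ false
  ¬every⇒∃ {suc n} {f} ¬all with f zero in f₀
  ... | false = zero , f₀
  ... | true  with ¬every⇒∃ ¬all
  ...   | i , fi = suc i , fi

  ∏ : ∀ {n} → (Fin n → ℕ) → ℕ
  ∏ {zero}  f = 1
  ∏ {suc n} f = f zero * ∏ (f ∘ suc)

  ∏-cong : ∀ {n} {f g : Fin n → ℕ} → (∀ i → f i ≡ g i) → ∏ f ≡ ∏ g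
  ∏-cong {zero}  f≗g = refl
  ∏-cong {suc n} f≗g = cong₂ _*_ (f≗g zero) (∏-cong (f≗g ∘ suc))

  countᴸ : ∀ {A : Set} → (A → Bool) → List A → ℕ
  countᴸ f []       = 0
  countᴸ f (x ∷ xs) = 𝟙 (f x) + countᴸ f xs

  countᴸ-cong : ∀ {A : Set} {f g : A → Bool} xs → (∀ x → f x ≡ g x) → countᴸ f xs ≡ countᴸ g xs
  countᴸ-cong []       f≗g = refl
  countᴸ-cong (x ∷ xs) f≗g = cong₂ _+_ (cong 𝟙 (f≗g x)) (countᴸ-cong xs f≗g)

  countᴸ-false : ∀ {A : Set} (xs : List A) → countᴸ (λ _ → false) xs ≡ 0
  countᴸ-false []       = refl
  countᴸ-false (x ∷ xs) = countᴸ-false xs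

  countᴸ-++ : ∀ {A : Set} (f : A → Bool) xs ys → countᴸ f (xs ++ ys) ≡ countᴸ f xs + countᴸ f ys
  countᴸ-++ f []       ys = refl
  countᴸ-++ f (x ∷ xs) ys = trans (cong (𝟙 (f x) +_) (countᴸ-++ f xs ys)) (sym (+-assoc (𝟙 (f x)) _ _))

  countᴸ-map : ∀ {A B : Set} (f : B → Bool) (g : A → B) xs → countᴸ f (map g xs) ≡ countᴸ (f ∘ g) xs
  countᴸ-map f g []       = refl
  countᴸ-map f g (x ∷ xs) = cong (𝟙 (f (g x)) +_) (countᴸ-map f g xs)

  countᴸ-filterᵇ : ∀ {A : Set} (f p : A → Bool) xs → countᴸ f (filterᵇ p xs) ≡ countᴸ (λ x → p x ∧ f x) xs
  countᴸ-filterᵇ f p []       = refl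
  countᴸ-filterᵇ f p (x ∷ xs) with p x
  ... | true  = cong (𝟙 (f x) +_) (countᴸ-filterᵇ f p xs)
  ... | false = countᴸ-filterᵇ f p xs

  countᴸ-cartesianProduct : ∀ {A : Set} {n} (f : Fin n × A → Bool) (ys : List A) →
    countᴸ f (cartesianProduct (allFin n) ys) ≡ sum (λ i → countᴸ (λ y → f (i , y)) ys)
  countᴸ-cartesianProduct {n = n} f ys = go id
    where
    go : ∀ {m} (g : Fin m → Fin n) →
      countᴸ f (cartesianProduct (tabulate g) ys) ≡ sum (λ i → countᴸ (λ y → f (g i , y)) ys)
    go {zero}  g = refl
    go {suc m} g = trans (countᴸ-++ f (map (g zero ,_) ys) _)
      (cong₂ _+_ (countᴸ-map f (g zero ,_) ys) (go (g ∘ suc)))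

  count-lookup : ∀ {A : Set} (f : A → Bool) xs → count (λ k → f (lookupᴸ xs k)) ≡ countᴸ f xs
  count-lookup f []       = refl
  count-lookup f (x ∷ xs) = cong (𝟙 (f x) +_) (count-lookup f xs)

  every-∧ : ∀ {n} (f g : Fin n → Bool) → every (λ i → f i ∧ g i) ≡ every f ∧ every g
  every-∧ {zero}  f g = refl
  every-∧ {suc n} f g rewrite every-∧ (f ∘ suc) (g ∘ suc) with f zero | g zero
  ... | true  | true  = refl
  ... | true  | false = sym (∧-zeroʳ (every (f ∘ suc)))
  ... | false | _     = refl

  false⇒¬every : ∀ {n} {f : Fin n → Bool} i → f i ≡ false → every f ≡ false
  false⇒¬every {f = f} i fi≡false with every f in all
  ... | false = refl
  ... | true  = trans (sym (every⇒ all i)) fi≡false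

  ∏-if : ∀ {n} (U W : Fin n → Bool) α β γ → (∀ x → (U x ∧ W x) ≡ false) →
    ∏ (λ x → if U x then α else if W x then β else γ) * γ ^ (count U + count W)
      ≡ α ^ count U * β ^ count W * γ ^ n
  ∏-if {zero}  U W α β γ U∩W=∅ = refl
  ∏-if {suc n} U W α β γ U∩W=∅ = step (U zero) (W zero) (U∩W=∅ zero)
    where
    open ≡-Reasoning
    P = ∏ (λ x → if U (suc x) then α else if W (suc x) then β else γ)
    u = count (U ∘ suc)
    w = count (W ∘ suc)
    IH : P * γ ^ (u + w) ≡ α ^ u * β ^ w * γ ^ n
    IH = ∏-if (U ∘ suc) (W ∘ suc) α β γ (U∩W=∅ ∘ suc)
    regroup : ∀ a p g x → a * p * (g * x) ≡ a * g * (p * x)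
    regroup a p g x = solve (a ∷ p ∷ g ∷ x ∷ [])
    gather₁ : ∀ a g A B G → a * g * (A * B * G) ≡ a * A * B * (g * G)
    gather₁ a g A B G = solve (a ∷ g ∷ A ∷ B ∷ G ∷ [])
    gather₂ : ∀ b g A B G → b * g * (A * B * G) ≡ A * (b * B) * (g * G)
    gather₂ b g A B G = solve (b ∷ g ∷ A ∷ B ∷ G ∷ [])
    step : ∀ u₀ w₀ → (u₀ ∧ w₀) ≡ false →
      (if u₀ then α else if w₀ then β else γ) * P * γ ^ (𝟙 u₀ + u + (𝟙 w₀ + w))
        ≡ α ^ (𝟙 u₀ + u) * β ^ (𝟙 w₀ + w) * γ ^ suc n
    step true  false _ = begin
      α * P * (γ * γ ^ (u + w))          ≡⟨ regroup α P γ _ ⟩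
      α * γ * (P * γ ^ (u + w))          ≡⟨ cong (α * γ *_) IH ⟩
      α * γ * (α ^ u * β ^ w * γ ^ n)    ≡⟨ gather₁ α γ (α ^ u) (β ^ w) (γ ^ n) ⟩
      α * α ^ u * β ^ w * (γ * γ ^ n)    ∎
    step false true  _ = begin
      β * P * γ ^ (u + suc w)            ≡⟨ cong (λ e → β * P * γ ^ e) (+-suc u w) ⟩
      β * P * (γ * γ ^ (u + w))          ≡⟨ regroup β P γ _ ⟩
      β * γ * (P * γ ^ (u + w))          ≡⟨ cong (β * γ *_) IH ⟩
      β * γ * (α ^ u * β ^ w * γ ^ n)    ≡⟨ gather₂ β γ (α ^ u) (β ^ w) (γ ^ n) ⟩
      α ^ u * (β * β ^ w) * (γ * γ ^ n)  ∎
    step false false _ = begin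
      γ * P * γ ^ (u + w)                ≡⟨ *-assoc γ P _ ⟩
      γ * (P * γ ^ (u + w))              ≡⟨ cong (γ *_) IH ⟩
      γ * (α ^ u * β ^ w * γ ^ n)        ≡⟨ x∙yz≈y∙xz γ (α ^ u * β ^ w) (γ ^ n) ⟩
      α ^ u * β ^ w * (γ * γ ^ n)        ∎

module CountingMeasures where
  open import Data.Nat using (ℕ; _+_; _<_)
  open import Data.Bool using (Bool; true; _∧_; not)
  open import Data.Product using (∃)
  open import Relation.Binary.PropositionalEquality using (_≡_)

  record CountingMeasure (Ω : Set) : Set where
    field
      μ         : (Ω → Bool) → ℕ
      μ-cong    : ∀ {P Q} → (∀ ω → P ω ≡ Q ω) → μ P ≡ μ Q
      μ-split   : ∀ (P Q : Ω → Bool) → μ P ≡ μ (λ ω → P ω ∧ Q ω) + μ (λ ω → P ω ∧ not (Q ω))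
      μ-witness : ∀ P → 0 < μ P → ∃ λ ω → P ω ≡ true

open CountingMeasures using (CountingMeasure)

module LovaszLocalLemma {Ω : Set} (M : CountingMeasure Ω) where
  open import Data.Nat using (ℕ; zero; suc; _+_; _*_; _∸_; _^_; _≤_; _<_; z≤n; s≤s; NonZero; >-nonZero; >-nonZero⁻¹)
  open import Data.Nat.Properties
  open import Data.Nat.Tactic.RingSolver using (solve)
  open import Data.Bool using (Bool; true; false; _∧_; _∨_; not)
  open import Data.Bool.Properties using (∨-identityʳ; ∧-zeroʳ; ∧-comm; ∨-zeroʳ; ∧-conicalˡ; ∧-conicalʳ; not-injective; ⇔→≡)
  open import Data.Fin using (Fin; zero; suc)
  open import Data.List using ([]; _∷_)
  open import Data.Product using (∃; _,_; proj₁; proj₂; map₂)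
  open import Function.Bundles using (mk⇔)
  open import Relation.Binary.PropositionalEquality
  open import Algebra.Properties.CommutativeSemigroup *-commutativeSemigroup using (x∙yz≈y∙xz; xy∙z≈zy∙x; interchange)
  open Counting
  open CountingMeasure M

  d^d*[1+d]^s≤[1+d]^d*d^s : ∀ {s d} → s ≤ d → d ^ d * suc d ^ s ≤ suc d ^ d * d ^ s
  d^d*[1+d]^s≤[1+d]^d*d^s {s} {d} s≤d = begin
    d ^ d * K ^ s                 ≡⟨ cong (λ e → d ^ e * K ^ s) d≡s+e ⟩
    d ^ (s + e) * K ^ s           ≡⟨ cong (_* K ^ s) (^-distribˡ-+-* d s e) ⟩
    d ^ s * d ^ e * K ^ s         ≤⟨ *-monoˡ-≤ (K ^ s) (*-monoʳ-≤ (d ^ s) (^-monoˡ-≤ e (n≤1+n d))) ⟩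
    d ^ s * K ^ e * K ^ s         ≡⟨ xy∙z≈zy∙x (d ^ s) (K ^ e) (K ^ s) ⟩
    K ^ s * K ^ e * d ^ s         ≡⟨ cong (_* d ^ s) (sym (^-distribˡ-+-* K s e)) ⟩
    K ^ (s + e) * d ^ s           ≡⟨ cong (λ e → K ^ e * d ^ s) (sym d≡s+e) ⟩
    K ^ d * d ^ s                 ∎
    where
    open ≤-Reasoning
    K = suc d
    e = d ∸ s
    d≡s+e : d ≡ s + e
    d≡s+e = sym (m+[n∸m]≡n s≤d)

  -- The arithmetic of one induction step: T, x, π, β₂ and β are the measures of Ω, A i ∩ Avoid S, A i,
  -- Avoid S₂ and Avoid S, where S₂ is S without its s events that A i depends on.
  step-arithmetic : ∀ {d s T x π β₂ β} → 1 ≤ d → 0 < T → s ≤ d →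
    T * x ≤ π * β₂ → suc d ^ suc d * π ≤ T * d ^ d → d ^ s * β₂ ≤ suc d ^ s * β →
    suc d * x ≤ β
  step-arithmetic {d} {s} {T} {x} {π} {β₂} {β} 1≤d T>0 s≤d indep prob grow =
    *-cancelˡ-≤ Q {{Q≢0}} (begin
      Q * (K * x)                    ≡⟨ regroup₁ T (K ^ d) (d ^ s) K x ⟩
      K * K ^ d * d ^ s * (T * x)    ≤⟨ *-monoʳ-≤ (K * K ^ d * d ^ s) indep ⟩
      K * K ^ d * d ^ s * (π * β₂)   ≡⟨ interchange (K * K ^ d) (d ^ s) π β₂ ⟩
      K * K ^ d * π * (d ^ s * β₂)   ≤⟨ *-mono-≤ prob grow ⟩
      T * d ^ d * (K ^ s * β)        ≡⟨ regroup₂ T (d ^ d) (K ^ s) β ⟩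
      T * (d ^ d * K ^ s) * β        ≤⟨ *-monoˡ-≤ β (*-monoʳ-≤ T (d^d*[1+d]^s≤[1+d]^d*d^s s≤d)) ⟩
      Q * β                          ∎)
    where
    open ≤-Reasoning
    K = suc d
    Q = T * (K ^ d * d ^ s)
    Q≢0 : NonZero Q
    Q≢0 = >-nonZero (*-mono-< T>0 (*-mono-< (m^n>0 K d) (m^n>0 d {{>-nonZero 1≤d}} s)))
    regroup₁ : ∀ t a b k y → t * (a * b) * (k * y) ≡ k * a * b * (t * y)
    regroup₁ t a b k y = solve (t ∷ a ∷ b ∷ k ∷ y ∷ [])
    regroup₂ : ∀ t a b y → t * a * (b * y) ≡ t * (a * b) * y
    regroup₂ t a b y = solve (t ∷ a ∷ b ∷ y ∷ [])

  μ-mono : ∀ {P Q : Ω → Bool} → (∀ ω → P ω ≡ true → Q ω ≡ true) → μ P ≤ μ Q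
  μ-mono {P} {Q} P⇒Q = begin
    μ P                                                ≡⟨ μ-cong Q∧P≗P ⟨
    μ (λ ω → Q ω ∧ P ω)                                ≤⟨ m≤m+n _ _ ⟩
    μ (λ ω → Q ω ∧ P ω) + μ (λ ω → Q ω ∧ not (P ω))    ≡⟨ μ-split Q P ⟨
    μ Q                                                ∎
    where
    open ≤-Reasoning
    Q∧P≗P : ∀ ω → (Q ω ∧ P ω) ≡ P ω
    Q∧P≗P ω with P ω in Pω
    ... | true  rewrite P⇒Q ω Pω = refl
    ... | false = ∧-zeroʳ (Q ω)

  module _ {E : ℕ} (A : Fin E → Ω → Bool) where

    Avoid : (Fin E → Bool) → Ω → Bool
    Avoid S ω = every (λ k → not (S k ∧ A k ω))

    Avoid⇒ : ∀ {S ω} → Avoid S ω ≡ true → ∀ k → S k ≡ true → A k ω ≡ false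
    Avoid⇒ {S} {ω} avoid k k∈S with every⇒ avoid k
    ... | ¬[k∈S∧Ak] rewrite k∈S = not-injective ¬[k∈S∧Ak]

    ⇒Avoid : ∀ {S ω} → (∀ k → S k ≡ true → A k ω ≡ false) → Avoid S ω ≡ true
    ⇒Avoid {S} {ω} avoid = ⇒every λ k → lemma k
      where
      lemma : ∀ k → not (S k ∧ A k ω) ≡ true
      lemma k with S k in k∈S
      ... | false = refl
      ... | true  rewrite avoid k k∈S = refl

    Avoid-anti : ∀ {S S′ ω} → (∀ k → S′ k ≡ true → S k ≡ true) → Avoid S ω ≡ true → Avoid S′ ω ≡ true
    Avoid-anti S′⊆S avoid = ⇒Avoid (λ k k∈S′ → Avoid⇒ avoid k (S′⊆S k k∈S′))

    Avoid-cong : ∀ {S S′} → (∀ k → S k ≡ S′ k) → ∀ ω → Avoid S ω ≡ Avoid S′ ω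
    Avoid-cong S≗S′ ω = every-cong (λ k → cong (λ b → not (b ∧ A k ω)) (S≗S′ k))

    Avoid-insert : ∀ S j → μ (Avoid S) ≡ μ (λ ω → A j ω ∧ Avoid S ω) + μ (Avoid (λ k → S k ∨ (j == k)))
    Avoid-insert S j = trans (μ-split (Avoid S) (A j)) (cong₂ _+_ (μ-cong (λ ω → ∧-comm (Avoid S ω) (A j ω))) (μ-cong avoid-both))
      where
      S∪j : Fin E → Bool
      S∪j k = S k ∨ (j == k)
      S⊆S∪j : ∀ k → S k ≡ true → S∪j k ≡ true
      S⊆S∪j k k∈S rewrite k∈S = refl
      j∈S∪j : S∪j j ≡ true
      j∈S∪j = trans (cong (S j ∨_) (==-refl j)) (∨-zeroʳ (S j))
      avoid-both : ∀ ω → (Avoid S ω ∧ not (A j ω)) ≡ Avoid S∪j ω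
      avoid-both ω = ⇔→≡ {z = true} (mk⇔ to from)
        where
        to : (Avoid S ω ∧ not (A j ω)) ≡ true → Avoid S∪j ω ≡ true
        to h = ⇒Avoid avoid
          where
          avoid : ∀ k → S∪j k ≡ true → A k ω ≡ false
          avoid k k∈S∪j with S k in k∈S
          ... | true  = Avoid⇒ (∧-conicalˡ _ _ h) k k∈S
          ... | false with refl ← ==⇒≡ {i = j} {k} k∈S∪j = not-injective (∧-conicalʳ _ _ h)
        from : Avoid S∪j ω ≡ true → (Avoid S ω ∧ not (A j ω)) ≡ true
        from h rewrite Avoid-anti S⊆S∪j h | Avoid⇒ h j j∈S∪j = refl

    module _ (d : ℕ) where

      -- Claim S says Pr[A i | Avoid S] ≤ 1/(d+1) for every i.
      Claim : (Fin E → Bool) → Set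
      Claim S = ∀ i → suc d * μ (λ ω → A i ω ∧ Avoid S ω) ≤ μ (Avoid S)

      Avoid-insert-≥ : ∀ {S} → Claim S → ∀ j → d * μ (Avoid S) ≤ suc d * μ (Avoid (λ k → S k ∨ (j == k)))
      Avoid-insert-≥ {S} claim j = +-cancelˡ-≤ (μ (Avoid S)) _ _ (begin
        suc d * μ (Avoid S)                 ≡⟨ cong (suc d *_) (Avoid-insert S j) ⟩
        suc d * (μ (λ ω → A j ω ∧ Avoid S ω) + μ (Avoid S∪j))
                                            ≡⟨ *-distribˡ-+ (suc d) (μ (λ ω → A j ω ∧ Avoid S ω)) (μ (Avoid S∪j)) ⟩
        suc d * μ (λ ω → A j ω ∧ Avoid S ω) + suc d * μ (Avoid S∪j)
                                            ≤⟨ +-monoˡ-≤ _ (claim j) ⟩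
        μ (Avoid S) + suc d * μ (Avoid S∪j) ∎)
        where
        open ≤-Reasoning
        S∪j : Fin E → Bool
        S∪j k = S k ∨ (j == k)

      -- Adding the r elements of R to U one at a time, each costing a factor d/(d+1).
      Avoid-∪-≥ : ∀ c → (∀ S → count S < c → Claim S) →
        ∀ r U R → count R ≡ r → count U + r ≤ c →
        d ^ r * μ (Avoid U) ≤ suc d ^ r * μ (Avoid (λ k → U k ∨ R k))
      Avoid-∪-≥ c claims zero U R |R|≡0 _ = ≤-reflexive (cong (1 *_) (μ-cong (Avoid-cong U≗U∪R)))
        where
        U≗U∪R : ∀ k → U k ≡ (U k ∨ R k)
        U≗U∪R k rewrite count≡0⇒false R |R|≡0 k = sym (∨-identityʳ (U k))
      Avoid-∪-≥ c claims (suc r) U R |R|≡1+r |U|+1+r≤c = begin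
        d * d ^ r * μ (Avoid U)              ≡⟨ *-assoc d (d ^ r) _ ⟩
        d * (d ^ r * μ (Avoid U))            ≤⟨ *-monoʳ-≤ d IH ⟩
        d * (suc d ^ r * μ (Avoid U∪R′))     ≡⟨ x∙yz≈y∙xz d (suc d ^ r) _ ⟩
        suc d ^ r * (d * μ (Avoid U∪R′))     ≤⟨ *-monoʳ-≤ (suc d ^ r) (Avoid-insert-≥ (claims U∪R′ |U∪R′|<c) j) ⟩
        suc d ^ r * (suc d * μ (Avoid U∪R′∪j)) ≡⟨ cong (λ m → suc d ^ r * (suc d * m)) (μ-cong (Avoid-cong (remove-insert U R (proj₂ j∈R)))) ⟩
        suc d ^ r * (suc d * μ (Avoid U∪R))  ≡⟨ x∙yz≈y∙xz (suc d ^ r) (suc d) _ ⟩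
        suc d * (suc d ^ r * μ (Avoid U∪R))  ≡⟨ *-assoc (suc d) (suc d ^ r) _ ⟨
        suc d * suc d ^ r * μ (Avoid U∪R)    ∎
        where
        open ≤-Reasoning
        j∈R : ∃ λ j → R j ≡ true
        j∈R = count-pos⇒∃ R (subst (0 <_) (sym |R|≡1+r) (s≤s z≤n))
        j : Fin E
        j = proj₁ j∈R
        R′ U∪R′ U∪R′∪j U∪R : Fin E → Bool
        R′ k = R k ∧ not (j == k)
        U∪R′ k = U k ∨ R′ k
        U∪R′∪j k = U∪R′ k ∨ (j == k)
        U∪R k = U k ∨ R k
        |R′|≡r : count R′ ≡ r
        |R′|≡r = suc-injective (trans (sym (count-remove R (proj₂ j∈R))) |R|≡1+r)
        IH : d ^ r * μ (Avoid U) ≤ suc d ^ r * μ (Avoid U∪R′)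
        IH = Avoid-∪-≥ c claims r U R′ |R′|≡r (≤-trans (+-monoʳ-≤ (count U) (n≤1+n r)) |U|+1+r≤c)
        |U∪R′|<c : count U∪R′ < c
        |U∪R′|<c = begin-strict
          count U∪R′          ≤⟨ count-∨ U R′ ⟩
          count U + count R′  ≡⟨ cong (count U +_) |R′|≡r ⟩
          count U + r         <⟨ +-monoʳ-< (count U) (n<1+n r) ⟩
          count U + suc r     ≤⟨ |U|+1+r≤c ⟩
          c                   ∎

    module _ (Γ : Fin E → Fin E → Bool) (d : ℕ)
      (Γ-refl : ∀ i → Γ i i ≡ true)
      (|Γ|≤d : ∀ i → count (Γ i) ≤ d)
      (independent : ∀ i S → (∀ k → S k ≡ true → Γ i k ≡ false) →
        μ (λ _ → true) * μ (λ ω → A i ω ∧ Avoid S ω) ≡ μ (A i) * μ (Avoid S))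
      (μA≤ : ∀ i → suc d ^ suc d * μ (A i) ≤ μ (λ _ → true) * d ^ d)
      (μ⊤>0 : 0 < μ (λ _ → true))
      where

      1≤d : Fin E → 1 ≤ d
      1≤d i = ≤-trans (∈⇒1≤count (Γ i) (Γ-refl i)) (|Γ|≤d i)

      claims : ∀ c S → count S < c → Claim d S
      claims (suc c) S (s≤s |S|≤c) i =
        step-arithmetic (1≤d i) μ⊤>0 |S₁|≤d independence (μA≤ i)
          (subst (λ m → d ^ s * μ (Avoid S₂) ≤ suc d ^ s * m) (μ-cong (Avoid-cong S₂∪S₁≗S)) grow)
        where
        S₁ S₂ : Fin E → Bool
        S₁ k = S k ∧ Γ i k
        S₂ k = S k ∧ not (Γ i k)
        s = count S₁
        |S₁|≤d : s ≤ d
        |S₁|≤d = ≤-trans (count-mono (λ k → ∧-conicalʳ (S k) (Γ i k))) (|Γ|≤d i)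
        independence : μ (λ _ → true) * μ (λ ω → A i ω ∧ Avoid S ω) ≤ μ (A i) * μ (Avoid S₂)
        independence = ≤-trans (*-monoʳ-≤ (μ (λ _ → true)) (μ-mono weaken))
          (≤-reflexive (independent i S₂ (λ k k∈S₂ → not-injective (∧-conicalʳ (S k) _ k∈S₂))))
          where
          weaken : ∀ ω → (A i ω ∧ Avoid S ω) ≡ true → (A i ω ∧ Avoid S₂ ω) ≡ true
          weaken ω h rewrite ∧-conicalˡ (A i ω) _ h
            = Avoid-anti (λ k → ∧-conicalˡ (S k) _) (∧-conicalʳ (A i ω) _ h)
        grow : d ^ s * μ (Avoid S₂) ≤ suc d ^ s * μ (Avoid (λ k → S₂ k ∨ S₁ k))
        grow = Avoid-∪-≥ d c (claims c) s S₂ S₁ refl (≤-trans (≤-reflexive (sym (count-split S (Γ i)))) |S|≤c)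
        S₂∪S₁≗S : ∀ k → (S₂ k ∨ S₁ k) ≡ S k
        S₂∪S₁≗S k with S k | Γ i k
        ... | true  | true  = refl
        ... | true  | false = refl
        ... | false | _     = refl

      lovasz-local-lemma : ∃ λ ω → ∀ i → A i ω ≡ false
      lovasz-local-lemma = map₂ (λ avoid i → Avoid⇒ avoid i refl) (μ-witness (Avoid (λ _ → true)) μ-Avoid-all>0)
        where
        all-events : d ^ E * μ (Avoid (λ _ → false)) ≤ suc d ^ E * μ (Avoid (λ _ → true))
        all-events = Avoid-∪-≥ d E (claims E) E (λ _ → false) (λ _ → true) (count-true E)
          (≤-reflexive (cong (_+ E) (count-false E)))
        d^E>0 : ∀ n → (Fin n → 1 ≤ d) → 0 < d ^ n
        d^E>0 zero    _   = s≤s z≤n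
        d^E>0 (suc n) 1≤d = m^n>0 d {{>-nonZero (1≤d zero)}} (suc n)
        d^E*μ⊤>0 : 0 < d ^ E * μ (Avoid (λ _ → false))
        d^E*μ⊤>0 = *-mono-< (d^E>0 E 1≤d) (subst (0 <_) (μ-cong (λ _ → sym (⇒every {E} (λ _ → refl)))) μ⊤>0)
        μ-Avoid-all>0 : 0 < μ (Avoid (λ _ → true))
        μ-Avoid-all>0 = >-nonZero⁻¹ _ {{m*n≢0⇒n≢0 (suc d ^ E) {{>-nonZero (<-≤-trans d^E*μ⊤>0 all-events)}}}}

module ProductSpace (b : ℕ) where
  open import Data.Nat using (ℕ; zero; suc; _+_; _*_; _^_; _<_)
  open import Data.Nat.Properties
  open import Data.Bool using (Bool; true; false; _∧_; not)
  open import Data.Fin using (Fin; zero; suc; _↑ˡ_; _↑ʳ_; combine)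
  open import Data.Vec using (Vec; []; _∷_; lookup; take; drop)
  open import Data.Vec.Properties using (lookup-++ˡ; lookup-++ʳ; take++drop≡id)
  open import Data.Product using (∃; _,_)
  open import Data.Empty using (⊥-elim)
  open import Function using (_∘_)
  open import Relation.Binary.PropositionalEquality
  open Counting
  open CountingMeasures using (CountingMeasure)

  Ω : ℕ → Set
  Ω N = Vec (Fin b) N

  -- Outcomes are colourings of N coordinates with b colours, all equally likely; μ P counts the
  -- outcomes in P, so the probability of P is μ P / b ^ N.
  μ : ∀ {N} → (Ω N → Bool) → ℕ
  μ {zero}  P = 𝟙 (P [])
  μ {suc N} P = sum (λ c → μ (λ ω → P (c ∷ ω)))

  μ-cong : ∀ {N} {P Q : Ω N → Bool} → (∀ ω → P ω ≡ Q ω) → μ P ≡ μ Q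
  μ-cong {zero}  P≗Q = cong 𝟙 (P≗Q [])
  μ-cong {suc N} P≗Q = sum-cong-≗ (λ c → μ-cong (λ ω → P≗Q (c ∷ ω)))

  μ-split : ∀ {N} (P Q : Ω N → Bool) → μ P ≡ μ (λ ω → P ω ∧ Q ω) + μ (λ ω → P ω ∧ not (Q ω))
  μ-split {zero}  P Q with P [] | Q []
  ... | true  | true  = refl
  ... | true  | false = refl
  ... | false | _     = refl
  μ-split {suc N} P Q = trans (sum-cong-≗ (λ c → μ-split (λ ω → P (c ∷ ω)) (λ ω → Q (c ∷ ω)))) (∑-distrib-+ {b} _ _)

  μ-witness : ∀ {N} (P : Ω N → Bool) → 0 < μ P → ∃ λ ω → P ω ≡ true
  μ-witness {zero}  P μP>0 with P [] in P[]
  ... | true = [] , P[]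
  μ-witness {suc N} P μP>0 with sum-pos⇒∃ _ μP>0
  ... | c , μPc>0 with μ-witness (λ ω → P (c ∷ ω)) μPc>0
  ...   | ω , Pcω = c ∷ ω , Pcω

  μ-true : ∀ N → μ {N} (λ _ → true) ≡ b ^ N
  μ-true zero    = refl
  μ-true (suc N) = trans (sum-cong-≗ {b} (λ _ → μ-true N)) (sum-const b (b ^ N))

  μ-const-∧ : ∀ {N} β (R : Ω N → Bool) → μ (λ ω → β ∧ R ω) ≡ 𝟙 β * μ R
  μ-const-∧ true  R = sym (+-identityʳ (μ R))
  μ-const-∧ {N} false R = μ-false N
    where
    μ-false : ∀ N → μ {N} (λ _ → false) ≡ 0
    μ-false zero    = refl
    μ-false (suc N) = trans (sum-cong-≗ {b} (λ _ → μ-false N)) (count-false b)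

  DependsOn : ∀ {N} → (Fin N → Bool) → (Ω N → Bool) → Set
  DependsOn {N} X P = ∀ ω ω′ → (∀ k → X k ≡ true → lookup ω k ≡ lookup ω′ k) → P ω ≡ P ω′

  DependsOn-tail : ∀ {N X} {P : Ω (suc N) → Bool} c → DependsOn X P → DependsOn (X ∘ suc) (λ ω → P (c ∷ ω))
  DependsOn-tail c dep ω ω′ agree = dep (c ∷ ω) (c ∷ ω′) λ { zero _ → refl ; (suc k) → agree k }

  DependsOn-head : ∀ {N X} {P : Ω (suc N) → Bool} → X zero ≡ false → DependsOn X P →
    ∀ c c′ ω → P (c ∷ ω) ≡ P (c′ ∷ ω)
  DependsOn-head X₀≡false dep c c′ ω = dep (c ∷ ω) (c′ ∷ ω) λ
    { zero X₀≡true → ⊥-elim (false≢true (trans (sym X₀≡false) X₀≡true)) ; (suc k) _ → refl }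
    where
    false≢true : false ≢ true
    false≢true ()

  μ-independent : ∀ {N} (X : Fin N → Bool) {P Q : Ω N → Bool} → DependsOn X P → DependsOn (not ∘ X) Q →
    b ^ N * μ (λ ω → P ω ∧ Q ω) ≡ μ P * μ Q
  μ-independent {zero}  X {P} {Q} _ _ = trans (+-identityʳ _) (𝟙-∧ (P []) (Q []))
  μ-independent {suc N} X {P} {Q} dP dQ = begin
    b * b ^ N * sum (λ c → μ (λ ω → P (c ∷ ω) ∧ Q (c ∷ ω)))    ≡⟨ *-assoc b (b ^ N) _ ⟩
    b * (b ^ N * sum (λ c → μ (λ ω → P (c ∷ ω) ∧ Q (c ∷ ω))))
      ≡⟨ cong (b *_) (*-distribˡ-sum (b ^ N) (λ c → μ (λ ω → P (c ∷ ω) ∧ Q (c ∷ ω)))) ⟩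
    b * sum (λ c → b ^ N * μ (λ ω → P (c ∷ ω) ∧ Q (c ∷ ω)))    ≡⟨ cong (b *_) (sum-cong-≗ {b} IH) ⟩
    b * sum (λ c → p c * q c)                                   ≡⟨ factor (X zero) refl ⟩
    sum p * sum q                                               ∎
    where
    open ≡-Reasoning
    p q : Fin b → ℕ
    p c = μ (λ ω → P (c ∷ ω))
    q c = μ (λ ω → Q (c ∷ ω))
    IH : ∀ c → b ^ N * μ (λ ω → P (c ∷ ω) ∧ Q (c ∷ ω)) ≡ p c * q c
    IH c = μ-independent (X ∘ suc) (DependsOn-tail c dP) (DependsOn-tail c dQ)
    factor : ∀ x₀ → X zero ≡ x₀ → b * sum (λ c → p c * q c) ≡ sum p * sum q
    factor true  X₀≡true  = *-∑-const-factor p q λ c c′ →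
      μ-cong (DependsOn-head (cong not X₀≡true) dQ c c′)
    factor false X₀≡false = begin
      b * sum (λ c → p c * q c)   ≡⟨ cong (b *_) (sum-cong-≗ {b} (λ c → *-comm (p c) (q c))) ⟩
      b * sum (λ c → q c * p c)   ≡⟨ *-∑-const-factor q p (λ c c′ → μ-cong (DependsOn-head X₀≡false dP c c′)) ⟩
      sum q * sum p               ≡⟨ *-comm (sum q) (sum p) ⟩
      sum p * sum q               ∎

  μ-take-drop : ∀ m {n} (Q : Ω m → Bool) (R : Ω n → Bool) →
    μ (λ ω → Q (take m ω) ∧ R (drop m ω)) ≡ μ Q * μ R
  μ-take-drop zero    Q R = μ-const-∧ (Q []) R
  μ-take-drop (suc m) Q R = trans (sum-cong-≗ {b} (λ c → μ-take-drop m (λ ξ → Q (c ∷ ξ)) R))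
                                  (sym (*-distribʳ-sum (μ R) (λ c → μ (λ ξ → Q (c ∷ ξ)))))

  block : ∀ {n t} → Fin n → Ω (n * t) → Ω t
  block {suc n} {t} zero    ω = take t ω
  block {suc n} {t} (suc j) ω = block j (drop t ω)

  lookup-block : ∀ {n t} (j : Fin n) (ω : Ω (n * t)) x → lookup (block j ω) x ≡ lookup ω (combine j x)
  lookup-block {suc n} {t} zero    ω x = trans (sym (lookup-++ˡ (take t ω) (drop t ω) x))
                                               (cong (λ ω′ → lookup ω′ (x ↑ˡ n * t)) (take++drop≡id t ω))
  lookup-block {suc n} {t} (suc j) ω x = trans (lookup-block j (drop t ω) x) (trans
                                               (sym (lookup-++ʳ (take t ω) (drop t ω) (combine j x)))
                                               (cong (λ ω′ → lookup ω′ (t ↑ʳ combine j x)) (take++drop≡id t ω)))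

  μ-blocks : ∀ n {t} (Q : Ω t → Bool) → μ (λ (ω : Ω (n * t)) → every {n} (λ j → Q (block j ω))) ≡ μ Q ^ n
  μ-blocks zero    Q = refl
  μ-blocks (suc n) {t} Q = trans (μ-take-drop t Q (λ ω → every {n} (λ j → Q (block j ω))))
                                 (cong (μ Q *_) (μ-blocks n Q))

  μ-coordinatewise : ∀ {t} (L : Fin t → Fin b → Bool) →
    μ (λ ξ → every (λ x → L x (lookup ξ x))) ≡ ∏ (λ x → count (L x))
  μ-coordinatewise {zero}  L = refl
  μ-coordinatewise {suc t} L = begin
    sum (λ c → μ (λ ξ → L zero c ∧ rest ξ))  ≡⟨ sum-cong-≗ {b} (λ c → μ-const-∧ (L zero c) rest) ⟩
    sum (λ c → 𝟙 (L zero c) * μ rest)         ≡⟨ *-distribʳ-sum (μ rest) (𝟙 ∘ L zero) ⟨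
    count (L zero) * μ rest                   ≡⟨ cong (count (L zero) *_) (μ-coordinatewise (L ∘ suc)) ⟩
    count (L zero) * ∏ (λ x → count (L (suc x)))  ∎
    where
    open ≡-Reasoning
    rest : Ω t → Bool
    rest ξ = every (λ x → L (suc x) (lookup ξ x))

  productMeasure : ∀ N → CountingMeasure (Ω N)
  productMeasure N = record { μ = μ ; μ-cong = μ-cong ; μ-split = μ-split ; μ-witness = μ-witness }

module Fractions where
  open import Data.Nat as ℕ using (ℕ; zero; suc; _∸_; _^_; NonZero)
  open import Data.Nat.Properties as ℕ using (m*n≢0; m^n≢0)
  open import Data.Nat.Tactic.RingSolver using (solve)
  open import Data.Integer as ℤ using (+_; +≤+)
  import Data.Integer.Properties as ℤ
  import Data.Rational as ℚ
  open import Data.Rational using (toℚᵘ)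
  import Data.Rational.Properties as ℚ
  open import Data.Rational.Unnormalised as ℚᵘ using (ℚᵘ; *≡*; *≤*; 1ℚᵘ; _≃_; _≤_)
  import Data.Rational.Unnormalised.Properties as ℚᵘ
  open import Data.List using ([]; _∷_)
  open import Relation.Binary.PropositionalEquality

  frac : ℕ → (Y : ℕ) → .{{NonZero Y}} → ℚᵘ
  frac X Y = (+ X) ℚᵘ./ Y

  frac-≃ : ∀ {X X′} Y Y′ .{{_ : NonZero Y}} .{{_ : NonZero Y′}} →
    X ℕ.* Y′ ≡ X′ ℕ.* Y → frac X Y ≃ frac X′ Y′
  frac-≃ {X} {X′} (suc _) (suc _) eq = *≡* (trans (sym (ℤ.pos-* X _)) (trans (cong +_ eq) (ℤ.pos-* X′ _)))

  frac-≤ : ∀ {X X′} Y Y′ .{{_ : NonZero Y}} .{{_ : NonZero Y′}} →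
    X ℕ.* Y′ ℕ.≤ X′ ℕ.* Y → frac X Y ≤ frac X′ Y′
  frac-≤ {X} {X′} (suc _) (suc _) le = *≤* (subst₂ ℤ._≤_ (ℤ.pos-* X _) (ℤ.pos-* X′ _) (+≤+ le))

  frac-≤⁻¹ : ∀ {X X′} Y Y′ .{{_ : NonZero Y}} .{{_ : NonZero Y′}} →
    frac X Y ≤ frac X′ Y′ → X ℕ.* Y′ ℕ.≤ X′ ℕ.* Y
  frac-≤⁻¹ {X} {X′} (suc _) (suc _) le =
    ℤ.drop‿+≤+ (subst₂ ℤ._≤_ (sym (ℤ.pos-* X _)) (sym (ℤ.pos-* X′ _)) (ℚᵘ.drop-*≤* le))

  frac-* : ∀ X Y X′ Y′ .{{_ : NonZero Y}} .{{_ : NonZero Y′}} →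
    frac X Y ℚᵘ.* frac X′ Y′ ≃ frac (X ℕ.* X′) (Y ℕ.* Y′) {{m*n≢0 Y Y′}}
  frac-* X (suc y) X′ (suc y′) = *≡* (cong (ℤ._* (+ (suc y ℕ.* suc y′))) (sym (ℤ.pos-* X X′)))

  frac-+ : ∀ X Y X′ Y′ .{{_ : NonZero Y}} .{{_ : NonZero Y′}} →
    frac X Y ℚᵘ.+ frac X′ Y′ ≃ frac (X ℕ.* Y′ ℕ.+ X′ ℕ.* Y) (Y ℕ.* Y′) {{m*n≢0 Y Y′}}
  frac-+ X (suc y) X′ (suc y′) = *≡* (cong (ℤ._* (+ (suc y ℕ.* suc y′))) (sym (trans (ℤ.pos-+ (X ℕ.* suc y′) (X′ ℕ.* suc y))
    (cong₂ ℤ._+_ (ℤ.pos-* X (suc y′)) (ℤ.pos-* X′ (suc y))))))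

  1-frac : ∀ X Y .{{_ : NonZero Y}} → X ℕ.≤ Y → 1ℚᵘ ℚᵘ.- frac X Y ≃ frac (Y ∸ X) Y
  1-frac X (suc y) X≤Y = *≡* (trans (cong (ℤ._* + suc y) numerator) (cong (+ (suc y ∸ X) ℤ.*_) (cong +_ (sym (ℕ.*-identityˡ (suc y))))))
    where
    numerator : + 1 ℤ.* + suc y ℤ.+ (ℤ.- (+ X)) ℤ.* + 1 ≡ + (suc y ∸ X)
    numerator = trans (cong₂ ℤ._+_ (ℤ.*-identityˡ (+ suc y)) (ℤ.*-identityʳ (ℤ.- (+ X))))
                      (trans (ℤ.m-n≡m⊖n (suc y) X) (ℤ.⊖-≥ X≤Y))

  frac-nonNeg : ∀ X Y .{{_ : NonZero Y}} → ℚᵘ.NonNegative (frac X Y)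
  frac-nonNeg X (suc _) = ℤ.nonNeg

  _^ᵘ_ : ℚᵘ → ℕ → ℚᵘ
  x ^ᵘ zero  = 1ℚᵘ
  x ^ᵘ suc k = x ℚᵘ.* (x ^ᵘ k)

  ^ᵘ-cong : ∀ {x y} k → x ≃ y → x ^ᵘ k ≃ y ^ᵘ k
  ^ᵘ-cong zero    x≃y = ℚᵘ.≃-refl
  ^ᵘ-cong (suc k) x≃y = ℚᵘ.*-cong x≃y (^ᵘ-cong k x≃y)

  frac-^ : ∀ X Y k .{{_ : NonZero Y}} → frac X Y ^ᵘ k ≃ frac (X ^ k) (Y ^ k) {{m^n≢0 Y k}}
  frac-^ X Y zero    = ℚᵘ.≃-refl
  frac-^ X Y (suc k) = ℚᵘ.≃-trans (ℚᵘ.*-congˡ {frac X Y} (frac-^ X Y k)) (frac-* X Y (X ^ k) (Y ^ k) {{_}} {{m^n≢0 Y k}})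

  frac-+-same : ∀ X X′ Y .{{_ : NonZero Y}} → frac X Y ℚᵘ.+ frac X′ Y ≃ frac (X ℕ.+ X′) Y
  frac-+-same X X′ Y = ℚᵘ.≃-trans (frac-+ X Y X′ Y) (frac-≃ (Y ℕ.* Y) Y {{m*n≢0 Y Y}} (rearrange X X′ Y))
    where
    rearrange : ∀ x x′ y → (x ℕ.* y ℕ.+ x′ ℕ.* y) ℕ.* y ≡ (x ℕ.+ x′) ℕ.* (y ℕ.* y)
    rearrange x x′ y = solve (x ∷ x′ ∷ y ∷ [])

  toℚᵘ-/ : ∀ X Y .{{_ : NonZero Y}} → toℚᵘ ((+ X) ℚ./ Y) ≃ frac X Y
  toℚᵘ-/ X (suc Y) = ℚ.toℚᵘ-fromℚᵘ (ℚᵘ.mkℚᵘ (+ X) Y)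

module Euler where
  open import Data.Nat as ℕ using (ℕ; zero; suc; _+_; _*_; _∸_; _^_; _!; _≤_; NonZero)
  open import Data.Nat.Combinatorics using (_C_; _P_; nCk≡nPk/k!)
  open import Data.Nat.Combinatorics.Base using (_P′_)
  open import Data.Nat.Combinatorics.Specification using (k!∣nP′k)
  open import Data.Nat.DivMod using (m/n*n≡m)
  open import Data.Nat.Divisibility using (_∣_)
  open import Data.Nat.Properties
  open import Data.Rational as ℚ using (toℚᵘ)
  import Data.Rational.Properties as ℚ
  import Data.Rational.Unnormalised as ℚᵘ
  import Data.Rational.Unnormalised.Properties as ℚᵘ
  open import Data.Bool using (true)
  open import Data.Fin using (Fin; toℕ; inject₁; fromℕ)
  open import Data.Fin.Patterns using (0F)
  open import Data.Fin.Properties using (toℕ-inject₁; toℕ-fromℕ; toℕ≤pred[n])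
  open import Function using (_∘_)
  open import Relation.Binary.PropositionalEquality
  import Algebra.Definitions.RawSemiring ℕ.+-*-rawSemiring as Semiring
  open import Algebra.Properties.CommutativeSemigroup *-commutativeSemigroup using (xy∙z≈y∙xz)
  import Algebra.Properties.CommutativeSemiring.Binomial +-*-commutativeSemiring as Binomial
  open Counting using (sum; sum-cong-≗; sum-init-last)
  open Fractions

  ^-semiring : ∀ x n → x Semiring.^ n ≡ x ^ n
  ^-semiring x zero    = refl
  ^-semiring x (suc n) = cong (x *_) (^-semiring x n)

  ×-semiring : ∀ n x → n Semiring.× x ≡ n * x
  ×-semiring zero    x = refl
  ×-semiring (suc n) x = cong (x +_) (×-semiring n x)

  [1+d]^d-binomial : ∀ d → suc d ^ d ≡ sum (λ (i : Fin (suc d)) → (d C toℕ i) * d ^ (d ∸ toℕ i))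
  [1+d]^d-binomial d = trans (sym (^-semiring (1 + d) d)) (trans (Binomial.theorem d 1 d) (sum-cong-≗ {suc d} term))
    where
    term : ∀ i → Binomial.binomialTerm 1 d d i ≡ (d C toℕ i) * d ^ (d ∸ toℕ i)
    term i = trans (×-semiring (d C toℕ i) _) (cong ((d C toℕ i) *_) (trans
      (cong₂ _*_ (trans (^-semiring 1 (toℕ i)) (^-zeroˡ (toℕ i))) (^-semiring d (d ∸ toℕ i))) (+-identityʳ _)))

  C*!≤^ : ∀ n k → k ≤ n → (n C k) * k ! ≤ n ^ k
  C*!≤^ n k k≤n = begin
    (n C k) * k !                          ≡⟨ cong (_* k !) (nCk≡nPk/k! k≤n) ⟩
    ((n P k) ℕ./ k !) {{k !≢0}} * k !      ≡⟨ m/n*n≡m {{k !≢0}} (subst (k ! ∣_) (sym P≡P′) (k!∣nP′k k≤n)) ⟩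
    n P k                                  ≡⟨ P≡P′ ⟩
    n P′ k                                 ≤⟨ P′≤^ n k ⟩
    n ^ k                                  ∎
    where
    open ≤-Reasoning
    P≡P′ : n P k ≡ n P′ k
    P≡P′ with k ℕ.≤ᵇ n | ≤⇒≤ᵇ k≤n
    ... | true | _ = refl
    P′≤^ : ∀ n k → n P′ k ≤ n ^ k
    P′≤^ n zero    = ≤-refl
    P′≤^ n (suc k) = *-mono-≤ (m∸n≤m n k) (P′≤^ n k)

  toℚᵘ-eSum-suc : ∀ k → toℚᵘ (eSum (suc k)) ℚᵘ.≃ toℚᵘ (eSum k) ℚᵘ.+ frac 1 (suc k !) {{suc k !≢0}}
  toℚᵘ-eSum-suc k =
    ℚᵘ.≃-trans (ℚ.toℚᵘ-homo-+ (eSum k) _) (ℚᵘ.+-congʳ (toℚᵘ (eSum k)) (toℚᵘ-/ 1 (suc k !) {{suc k !≢0}}))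

  sum≤eSum : ∀ n (f : Fin (suc n) → ℕ) Y .{{_ : NonZero Y}} → (∀ i → f i * toℕ i ! ≤ Y) →
    frac (sum f) Y ℚᵘ.≤ toℚᵘ (eSum n)
  sum≤eSum zero    f Y f≤ = frac-≤ Y 1 (subst₂ _≤_ (cong (_* 1) (sym (+-identityʳ (f 0F)))) (sym (+-identityʳ Y)) (f≤ 0F))
  sum≤eSum (suc n) f Y f≤ = begin
    frac (sum f) Y                                              ≃⟨ frac-≃ Y Y (cong (_* Y) (sum-init-last f)) ⟩
    frac (sum (f ∘ inject₁) + f (fromℕ (suc n))) Y              ≃⟨ frac-+-same _ _ Y ⟨
    frac (sum (f ∘ inject₁)) Y ℚᵘ.+ frac (f (fromℕ (suc n))) Y  ≤⟨ ℚᵘ.+-mono-≤ init≤ last≤ ⟩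
    toℚᵘ (eSum n) ℚᵘ.+ frac 1 (suc n !) {{suc n !≢0}}           ≃⟨ toℚᵘ-eSum-suc n ⟨
    toℚᵘ (eSum (suc n))                                         ∎
    where
    open ℚᵘ.≤-Reasoning
    init≤ : frac (sum (f ∘ inject₁)) Y ℚᵘ.≤ toℚᵘ (eSum n)
    init≤ = sum≤eSum n (f ∘ inject₁) Y (λ i → subst (λ m → f (inject₁ i) * m ! ≤ Y) (toℕ-inject₁ i) (f≤ (inject₁ i)))
    last≤ : frac (f (fromℕ (suc n))) Y ℚᵘ.≤ frac 1 (suc n !) {{suc n !≢0}}
    last≤ = frac-≤ Y (suc n !) {{_}} {{suc n !≢0}}
      (subst₂ _≤_ (cong (λ m → f (fromℕ (suc n)) * m !) (toℕ-fromℕ (suc n))) (sym (+-identityʳ Y)) (f≤ (fromℕ (suc n))))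

  [1+1/d]^d≤e : ∀ d .{{_ : NonZero d}} → frac (suc d ^ d) (d ^ d) {{m^n≢0 d d}} ℚᵘ.≤ toℚᵘ (eSum d)
  [1+1/d]^d≤e d =
    ℚᵘ.≤-respˡ-≃ (frac-≃ (d ^ d) (d ^ d) {{m^n≢0 d d}} {{m^n≢0 d d}} (cong (_* d ^ d) (sym ([1+d]^d-binomial d))))
                 (sum≤eSum d (λ i → (d C toℕ i) * d ^ (d ∸ toℕ i)) (d ^ d) {{m^n≢0 d d}} term≤)
    where
    term≤ : ∀ (i : Fin (suc d)) → (d C toℕ i) * d ^ (d ∸ toℕ i) * toℕ i ! ≤ d ^ d
    term≤ i = begin
      (d C toℕ i) * d ^ (d ∸ toℕ i) * toℕ i !    ≡⟨ xy∙z≈y∙xz (d C toℕ i) (d ^ (d ∸ toℕ i)) (toℕ i !) ⟩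
      d ^ (d ∸ toℕ i) * ((d C toℕ i) * toℕ i !)  ≤⟨ *-monoʳ-≤ (d ^ (d ∸ toℕ i)) (C*!≤^ d (toℕ i) i≤d) ⟩
      d ^ (d ∸ toℕ i) * d ^ toℕ i                ≡⟨ ^-distribˡ-+-* d (d ∸ toℕ i) (toℕ i) ⟨
      d ^ (d ∸ toℕ i + toℕ i)                    ≡⟨ cong (d ^_) (m∸n+n≡m i≤d) ⟩
      d ^ d                                      ∎
      where
      open ≤-Reasoning
      i≤d : toℕ i ≤ d
      i≤d = toℕ≤pred[n] i

module Quantities where
  open import Data.Nat as ℕ using (ℕ; zero; suc; _∸_; _^_; NonZero)
  open import Data.Nat.Combinatorics using (_C_; nCk+nC[k+1]≡[n+1]C[k+1])
  open import Data.Nat.Coprimality using (Coprime)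
  open import Data.Nat.Properties as ℕ using (m^n≢0; m*n≢0)
  open import Data.Nat.Tactic.RingSolver using (solve)
  open import Data.Integer using (+_)
  import Data.Integer as ℤ
  import Data.Integer.Properties as ℤ
  open import Data.Integer.Tactic.RingSolver using () renaming (solve to ℤ-solve)
  open import Data.Rational as ℚ using (ℚ; 1ℚ; toℚᵘ)
  import Data.Rational.Properties as ℚ
  open import Data.Rational.Unnormalised as ℚᵘ using (ℚᵘ; 1ℚᵘ; _≃_)
  import Data.Rational.Unnormalised.Properties as ℚᵘ
  open import Data.List using ([]; _∷_)
  open import Data.Sum using (inj₁; inj₂)
  open import Relation.Binary.PropositionalEquality
  open Fractions
  open Euler using ([1+1/d]^d≤e)

  toℚᵘ-^ℚ : ∀ x k → toℚᵘ (x ^ℚ k) ≃ toℚᵘ x ^ᵘ k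
  toℚᵘ-^ℚ x zero    = ℚᵘ.≃-refl
  toℚᵘ-^ℚ x (suc k) = ℚᵘ.≃-trans (ℚ.toℚᵘ-homo-* x (x ^ℚ k)) (ℚᵘ.*-congˡ {toℚᵘ x} (toℚᵘ-^ℚ x k))

  toℚᵘ-1- : ∀ x → toℚᵘ (1ℚ ℚ.- x) ≃ 1ℚᵘ ℚᵘ.- toℚᵘ x
  toℚᵘ-1- x = ℚᵘ.≃-trans (ℚ.toℚᵘ-homo-+ 1ℚ (ℚ.- x)) (ℚᵘ.+-congʳ 1ℚᵘ (ℚ.toℚᵘ-homo‿- x))

  module _ (p : ℚ) (a b w : ℕ) .{{_ : NonZero b}} (a≤b : a ℕ.≤ b) (p≃a/b : toℚᵘ p ≃ frac a b) where

    private
      B A : ℕ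
      B = b ^ (2 ℕ.+ w)
      A = a ^ 2 ℕ.* (b ∸ a) ^ w
      instance
        B≢0 : NonZero B
        B≢0 = m^n≢0 b (2 ℕ.+ w)

    toℚᵘ-qOf : toℚᵘ (qOf p w) ≃ frac (B ∸ A) B
    toℚᵘ-qOf = begin
      toℚᵘ (qOf p w)                                     ≈⟨ toℚᵘ-1- ((p ℚ.* p) ℚ.* ((1ℚ ℚ.- p) ^ℚ w)) ⟩
      1ℚᵘ ℚᵘ.- toℚᵘ ((p ℚ.* p) ℚ.* ((1ℚ ℚ.- p) ^ℚ w))   ≈⟨ ℚᵘ.+-congʳ 1ℚᵘ (ℚᵘ.-‿cong p²[1-p]ʷ) ⟩
      1ℚᵘ ℚᵘ.- frac A′ B′ {{B′≢0}}                       ≈⟨ 1-frac A′ B′ {{B′≢0}} A′≤B′ ⟩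
      frac (B′ ∸ A′) B′ {{B′≢0}}
        ≈⟨ frac-≃ B′ B {{B′≢0}} (trans (cong₂ (λ x y → (x ∸ y) ℕ.* B) B′≡B A′≡A) (cong ((B ∸ A) ℕ.*_) (sym B′≡B))) ⟩
      frac (B ∸ A) B                                     ∎
      where
      open ℚᵘ.≃-Reasoning
      A′ = a ℕ.* a ℕ.* (b ∸ a) ^ w
      B′ = b ℕ.* b ℕ.* b ^ w
      B′≢0 : NonZero B′
      B′≢0 = m*n≢0 (b ℕ.* b) (b ^ w) {{m*n≢0 b b}} {{m^n≢0 b w}}
      B′≡B : B′ ≡ B
      B′≡B = ℕ.*-assoc b b (b ^ w)
      A′≡A : A′ ≡ A
      A′≡A = cong (λ x → a ℕ.* x ℕ.* (b ∸ a) ^ w) (sym (ℕ.*-identityʳ a))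
      A′≤B′ : A′ ℕ.≤ B′
      A′≤B′ = ℕ.*-mono-≤ (ℕ.*-mono-≤ a≤b a≤b) (ℕ.^-monoˡ-≤ w (ℕ.m∸n≤m b a))
      1-p≃ : toℚᵘ (1ℚ ℚ.- p) ≃ frac (b ∸ a) b
      1-p≃ = ℚᵘ.≃-trans (toℚᵘ-1- p) (ℚᵘ.≃-trans (ℚᵘ.+-congʳ 1ℚᵘ (ℚᵘ.-‿cong p≃a/b)) (1-frac a b a≤b))
      p²[1-p]ʷ : toℚᵘ ((p ℚ.* p) ℚ.* ((1ℚ ℚ.- p) ^ℚ w)) ≃ frac A′ B′ {{B′≢0}}
      p²[1-p]ʷ = ℚᵘ.≃-trans (ℚ.toℚᵘ-homo-* (p ℚ.* p) _) (ℚᵘ.≃-trans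
        (ℚᵘ.*-cong (ℚᵘ.≃-trans (ℚ.toℚᵘ-homo-* p p) (ℚᵘ.≃-trans (ℚᵘ.*-cong p≃a/b p≃a/b) (frac-* a b a b)))
                   (ℚᵘ.≃-trans (toℚᵘ-^ℚ (1ℚ ℚ.- p) w) (ℚᵘ.≃-trans (^ᵘ-cong w 1-p≃) (frac-^ (b ∸ a) b w))))
        (frac-* (a ℕ.* a) (b ℕ.* b) ((b ∸ a) ^ w) (b ^ w) {{m*n≢0 b b}} {{m^n≢0 b w}}))

    e*-hypothesis⇒ : ∀ n d → e* ((ℤtoℚ (+ d) ℚ.+ 1ℚ) ℚ.* (qOf p w ^ℚ n)) ≤1 →
      suc d ^ suc d ℕ.* (B ∸ A) ^ n ℕ.≤ d ^ d ℕ.* B ^ n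
    -- For d = 0 the claim reads 1 · (B ∸ A) ^ n ≤ 0 ^ 0 · B ^ n, true without the hypothesis.
    e*-hypothesis⇒ n zero     _   = ℕ.*-monoʳ-≤ 1 (ℕ.^-monoˡ-≤ n (ℕ.m∸n≤m B A))
    e*-hypothesis⇒ n d@(suc _) hyp = rearrange (frac-≤⁻¹ (d ^ d ℕ.* (1 ℕ.* B ^ n)) 1 {{d^d*Bⁿ≢0}}
      (ℚᵘ.≤-respˡ-≃ (frac-* (K ^ d) (d ^ d) (K ℕ.* (B ∸ A) ^ n) (1 ℕ.* B ^ n) {{d^d≢0}} {{1*Bⁿ≢0}}) bound))
      where
      K = suc d
      d^d≢0 : NonZero (d ^ d)
      d^d≢0 = m^n≢0 d d
      Bⁿ≢0 : NonZero (B ^ n)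
      Bⁿ≢0 = m^n≢0 B n
      1*Bⁿ≢0 : NonZero (1 ℕ.* B ^ n)
      1*Bⁿ≢0 = m*n≢0 1 (B ^ n) {{_}} {{Bⁿ≢0}}
      d^d*Bⁿ≢0 : NonZero (d ^ d ℕ.* (1 ℕ.* B ^ n))
      d^d*Bⁿ≢0 = m*n≢0 (d ^ d) (1 ℕ.* B ^ n) {{d^d≢0}} {{1*Bⁿ≢0}}
      [d+1]qⁿ : toℚᵘ ((ℤtoℚ (+ d) ℚ.+ 1ℚ) ℚ.* (qOf p w ^ℚ n)) ≃ frac (K ℕ.* (B ∸ A) ^ n) (1 ℕ.* B ^ n) {{1*Bⁿ≢0}}
      [d+1]qⁿ = ℚᵘ.≃-trans (ℚ.toℚᵘ-homo-* (ℤtoℚ (+ d) ℚ.+ 1ℚ) (qOf p w ^ℚ n))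
        (ℚᵘ.≃-trans (ℚᵘ.*-cong d+1 qⁿ) (frac-* K 1 ((B ∸ A) ^ n) (B ^ n) {{_}} {{Bⁿ≢0}}))
        where
        d+1 : toℚᵘ (ℤtoℚ (+ d) ℚ.+ 1ℚ) ≃ frac K 1
        d+1 = ℚᵘ.≃-trans (ℚ.toℚᵘ-homo-+ (ℤtoℚ (+ d)) 1ℚ) (ℚᵘ.≃-trans (ℚᵘ.+-congˡ 1ℚᵘ (toℚᵘ-/ d 1))
                (ℚᵘ.≃-trans (frac-+-same d 1 1) (frac-≃ 1 1 (cong (ℕ._* 1) (ℕ.+-comm d 1)))))
        qⁿ : toℚᵘ (qOf p w ^ℚ n) ≃ frac ((B ∸ A) ^ n) (B ^ n) {{Bⁿ≢0}}
        qⁿ = ℚᵘ.≃-trans (toℚᵘ-^ℚ (qOf p w) n) (ℚᵘ.≃-trans (^ᵘ-cong n toℚᵘ-qOf) (frac-^ (B ∸ A) B n))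
      bound : frac (K ^ d) (d ^ d) {{d^d≢0}} ℚᵘ.* frac (K ℕ.* (B ∸ A) ^ n) (1 ℕ.* B ^ n) {{1*Bⁿ≢0}} ℚᵘ.≤ frac 1 1
      bound = ℚᵘ.≤-trans (ℚᵘ.*-monoˡ-≤-nonNeg _ {{frac-nonNeg _ _ {{1*Bⁿ≢0}}}} ([1+1/d]^d≤e d))
        (ℚᵘ.≤-respˡ-≃ (ℚᵘ.≃-trans (ℚ.toℚᵘ-homo-* (eSum d) _) (ℚᵘ.*-congˡ {toℚᵘ (eSum d)} [d+1]qⁿ))
                      (ℚ.toℚᵘ-mono-≤ (hyp d)))
      rearrange : K ^ d ℕ.* (K ℕ.* (B ∸ A) ^ n) ℕ.* 1 ℕ.≤ 1 ℕ.* (d ^ d ℕ.* (1 ℕ.* B ^ n)) →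
                  K ^ K ℕ.* (B ∸ A) ^ n ℕ.≤ d ^ d ℕ.* B ^ n
      rearrange = subst₂ ℕ._≤_ (lhs (K ^ d) K ((B ∸ A) ^ n)) (rhs (d ^ d) (B ^ n))
        where
        lhs : ∀ x y z → x ℕ.* (y ℕ.* z) ℕ.* 1 ≡ y ℕ.* x ℕ.* z
        lhs x y z = solve (x ∷ y ∷ z ∷ [])
        rhs : ∀ x y → 1 ℕ.* (x ℕ.* (1 ℕ.* y)) ≡ x ℕ.* y
        rhs x y = solve (x ∷ y ∷ [])

  C-monoˡ : ∀ {m} n k → m ℕ.≤ n → m C k ℕ.≤ n C k
  C-monoˡ zero    k ℕ.z≤n = ℕ.≤-refl
  C-monoˡ (suc n) k m≤1+n with ℕ.m≤n⇒m<n∨m≡n m≤1+n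
  ... | inj₂ refl           = ℕ.≤-refl
  ... | inj₁ (ℕ.s≤s m≤n)    = ℕ.≤-trans (C-monoˡ n k m≤n) (nCk≤[1+n]Ck k)
    where
    nCk≤[1+n]Ck : ∀ k → n C k ℕ.≤ suc n C k
    nCk≤[1+n]Ck zero    = ℕ.≤-refl
    nCk≤[1+n]Ck (suc k) = ℕ.≤-trans (ℕ.m≤n+m (n C suc k) (n C k)) (ℕ.≤-reflexive (nCk+nC[k+1]≡[n+1]C[k+1] n k))

  DOf≡ : ∀ t m Δ w → let c = (t ∸ 2) C w ; c′ = (t ∸ (w ℕ.+ 4)) C w in
    DOf t m Δ w ≡ + (m ℕ.* c ℕ.+ (w ℕ.+ 2) ℕ.* Δ ℕ.* c′ ∸ m ℕ.* c′)
  DOf≡ t m Δ w = begin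
    + m ℤ.* + c ℤ.- (+ m ℤ.- + x) ℤ.* + c′          ≡⟨ rearrange (+ m) (+ c) (+ x) (+ c′) ⟩
    (+ m ℤ.* + c ℤ.+ + x ℤ.* + c′) ℤ.- + m ℤ.* + c′
      ≡⟨ cong₂ ℤ._-_ (sym (trans (ℤ.pos-+ (m ℕ.* c) (x ℕ.* c′)) (cong₂ ℤ._+_ (ℤ.pos-* m c) (ℤ.pos-* x c′))))
                     (sym (ℤ.pos-* m c′)) ⟩
    + (m ℕ.* c ℕ.+ x ℕ.* c′) ℤ.- + (m ℕ.* c′)       ≡⟨ ℤ.m-n≡m⊖n (m ℕ.* c ℕ.+ x ℕ.* c′) (m ℕ.* c′) ⟩
    (m ℕ.* c ℕ.+ x ℕ.* c′) ℤ.⊖ (m ℕ.* c′)           ≡⟨ ℤ.⊖-≥ mc′≤mc+xc′ ⟩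
    + (m ℕ.* c ℕ.+ x ℕ.* c′ ∸ m ℕ.* c′)             ∎
    where
    open ≡-Reasoning
    c = (t ∸ 2) C w
    c′ = (t ∸ (w ℕ.+ 4)) C w
    x = (w ℕ.+ 2) ℕ.* Δ
    mc′≤mc+xc′ : m ℕ.* c′ ℕ.≤ m ℕ.* c ℕ.+ x ℕ.* c′
    mc′≤mc+xc′ = ℕ.≤-trans
      (ℕ.*-monoʳ-≤ m (C-monoˡ (t ∸ 2) w (ℕ.∸-monoʳ-≤ t (ℕ.≤-trans (ℕ.m≤m+n 2 2) (ℕ.m≤n+m 4 w)))))
      (ℕ.m≤m+n (m ℕ.* c) (x ℕ.* c′))
    rearrange : ∀ m c x c′ → m ℤ.* c ℤ.- (m ℤ.- x) ℤ.* c′ ≡ (m ℤ.* c ℤ.+ x ℤ.* c′) ℤ.- m ℤ.* c′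
    rearrange m c x c′ = ℤ-solve (m ∷ c ∷ x ∷ c′ ∷ [])

  <1⇒numerator≤denominator : ∀ {a b′} .{c : Coprime a (suc b′)} → ℚ.mkℚ (+ a) b′ c ℚ.< 1ℚ → a ℕ.≤ suc b′
  <1⇒numerator≤denominator {a} {b′} p<1 =
    ℕ.<⇒≤ (ℤ.drop‿+<+ (subst₂ ℤ._<_ (ℤ.*-identityʳ (+ a)) (ℤ.*-identityˡ (+ suc b′)) (ℚ.drop-*<* p<1)))

module Subsets where
  open import Data.Nat using (zero; suc; _+_; _∸_; _≡ᵇ_)
  open import Data.Nat.Combinatorics using (_C_; nCk+nC[k+1]≡[n+1]C[k+1])
  open import Data.Nat.Properties using (+-∸-assoc)
  open import Data.Bool using (Bool; true; false; _∧_; not)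
  open import Data.Bool.Properties using (∧-zeroʳ; ∧-identityʳ; not-injective)
  open import Data.Fin using (Fin; zero; suc)
  open import Data.Fin.Subset using (Subset; inside; outside; ∣_∣)
  open import Data.Vec using ([]; _∷_; lookup)
  open import Data.List using (List; []; _∷_; _++_; map)
  open import Data.List.Membership.Propositional using (_∈_)
  open import Data.List.Membership.Propositional.Properties using (∈-++⁺ˡ; ∈-++⁺ʳ; ∈-map⁺)
  open import Data.List.Relation.Unary.Any using (here)
  open import Function using (_∘_)
  open import Relation.Binary.PropositionalEquality
  open Counting

  allSubsets : ∀ n → List (Subset n)
  allSubsets zero    = [] ∷ []
  allSubsets (suc n) = map (inside ∷_) (allSubsets n) ++ map (outside ∷_) (allSubsets n)

  ∈-allSubsets : ∀ {n} (W : Subset n) → W ∈ allSubsets n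
  ∈-allSubsets []            = here refl
  ∈-allSubsets (inside ∷ W)  = ∈-++⁺ˡ (∈-map⁺ (inside ∷_) (∈-allSubsets W))
  ∈-allSubsets (outside ∷ W) = ∈-++⁺ʳ (map (inside ∷_) (allSubsets _)) (∈-map⁺ (outside ∷_) (∈-allSubsets W))

  ∣W∣≡count : ∀ {n} (W : Subset n) → ∣ W ∣ ≡ count (lookup W)
  ∣W∣≡count []            = refl
  ∣W∣≡count (inside ∷ W)  = cong suc (∣W∣≡count W)
  ∣W∣≡count (outside ∷ W) = ∣W∣≡count W

  disjointᵇ : ∀ {n} → Subset n → (Fin n → Bool) → Bool
  disjointᵇ W Z = every (λ x → not (lookup W x ∧ Z x))

  disjointᵇ⇒∉ : ∀ {n} {W : Subset n} Z {x} → disjointᵇ W Z ≡ true → Z x ≡ true → lookup W x ≡ false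
  disjointᵇ⇒∉ {W = W} Z {x} W∩Z=∅ x∈Z with every⇒ W∩Z=∅ x
  ... | ¬[x∈W∩Z] rewrite x∈Z = trans (sym (∧-identityʳ (lookup W x))) (not-injective ¬[x∈W∩Z])

  countᴸ-w-subsets : ∀ n w (Z : Fin n → Bool) →
    countᴸ (λ W → (∣ W ∣ ≡ᵇ w) ∧ disjointᵇ W Z) (allSubsets n) ≡ (n ∸ count Z) C w
  countᴸ-w-subsets zero    zero    Z = refl
  countᴸ-w-subsets zero    (suc w) Z = refl
  countᴸ-w-subsets (suc n) w       Z = begin
    countᴸ F (map (inside ∷_) (allSubsets n) ++ map (outside ∷_) (allSubsets n))
      ≡⟨ countᴸ-++ F (map (inside ∷_) (allSubsets n)) _ ⟩
    countᴸ F (map (inside ∷_) (allSubsets n)) + countᴸ F (map (outside ∷_) (allSubsets n))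
      ≡⟨ cong₂ _+_ (countᴸ-map F (inside ∷_) (allSubsets n))
                   (trans (countᴸ-map F (outside ∷_) (allSubsets n)) (countᴸ-w-subsets n w (Z ∘ suc))) ⟩
    countᴸ (F ∘ (inside ∷_)) (allSubsets n) + (n ∸ count (Z ∘ suc)) C w
      ≡⟨ split (Z zero) refl w ⟩
    (suc n ∸ count Z) C w ∎
    where
    open ≡-Reasoning
    F : Subset (suc n) → Bool
    F W = (∣ W ∣ ≡ᵇ w) ∧ disjointᵇ W Z
    c = count (Z ∘ suc)
    split : ∀ z → Z zero ≡ z → ∀ w →
      countᴸ (λ W → (suc ∣ W ∣ ≡ᵇ w) ∧ (not (Z zero) ∧ disjointᵇ W (Z ∘ suc))) (allSubsets n) + (n ∸ c) C w
        ≡ (suc n ∸ count Z) C w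
    split true  Z₀ w rewrite Z₀ = cong (_+ (n ∸ c) C w)
      (trans (countᴸ-cong (allSubsets n) (λ W → ∧-zeroʳ (suc ∣ W ∣ ≡ᵇ w))) (countᴸ-false (allSubsets n)))
    split false _  zero    = cong (_+ 1) (countᴸ-false (allSubsets n))
    split false Z₀ (suc w) rewrite Z₀ = begin
      countᴸ (λ W → (∣ W ∣ ≡ᵇ w) ∧ disjointᵇ W (Z ∘ suc)) (allSubsets n) + (n ∸ c) C suc w
        ≡⟨ cong (_+ (n ∸ c) C suc w) (countᴸ-w-subsets n w (Z ∘ suc)) ⟩
      (n ∸ c) C w + (n ∸ c) C suc w          ≡⟨ nCk+nC[k+1]≡[n+1]C[k+1] (n ∸ c) w ⟩
      suc (n ∸ c) C suc w                    ≡⟨ cong (λ m → m C suc w) (+-∸-assoc 1 (count≤n (Z ∘ suc))) ⟨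
      (suc n ∸ c) C suc w                    ∎

module GraphCounting {t : ℕ} (G : Graph t) where
  open import Data.Nat using (ℕ; zero; suc; _+_; _*_; _⊔_; _≤_; _<_; _<ᵇ_; z≤n; s≤s)
  open import Data.Nat.Properties
  open import Data.Bool using (Bool; true; false; _∧_; not; if_then_else_; T)
  open import Data.Bool.Properties using (∧-comm; ∧-zeroʳ; ∧-identityʳ; ⇔→≡; T-≡)
  open import Data.Fin using (Fin; zero; suc; toℕ)
  open import Data.Fin.Properties using (toℕ-injective)
  import Data.Fin.Subset as Subset
  open import Data.Vec using (lookup)
  open import Data.Vec.Properties using (lookup⇒[]=; []=⇒lookup; lookup-zipWith; lookup∘tabulate)
  open import Data.List using (tabulate; foldr; map)
  open import Data.Empty using (⊥-elim)
  open import Function using (id; _∘_)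
  open import Function.Bundles using (Equivalence; mk⇔)
  open import Relation.Binary.PropositionalEquality
  open Counting
  open Subsets using (∣W∣≡count)

  adj : Fin t → Fin t → Bool
  adj u v = lookup (nbr G u) v

  adj-sym : ∀ u v → adj u v ≡ adj v u
  adj-sym u v = ⇔→≡ {z = true} (mk⇔ (adj⇒adjᵒᵖ u v) (adj⇒adjᵒᵖ v u))
    where
    adj⇒adjᵒᵖ : ∀ u v → adj u v ≡ true → adj v u ≡ true
    adj⇒adjᵒᵖ u v uv = []=⇒lookup (symmetric G (lookup⇒[]= v (nbr G u) uv))

  adj-irrefl : ∀ u → adj u u ≡ false
  adj-irrefl u with adj u u in uu
  ... | true  = ⊥-elim (irrefl G (lookup⇒[]= u (nbr G u) uu))
  ... | false = refl

  edge : Fin t → Fin t → Bool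
  edge u v = (toℕ u <ᵇ toℕ v) ∧ adj u v

  edge⇒≢ : ∀ {u v} → edge u v ≡ true → u ≢ v
  edge⇒≢ {u} uu refl rewrite adj-irrefl u | ∧-zeroʳ (toℕ u <ᵇ toℕ u) with uu
  ... | ()

  <⇒edge : ∀ {u v} → toℕ u < toℕ v → adj u v ≡ true → edge u v ≡ true
  <⇒edge {u} {v} u<v uv rewrite uv = trans (∧-identityʳ _) (Equivalence.to T-≡ (<⇒<ᵇ u<v))

  ≮ᵇ∧≯ᵇ⇒≡ : ∀ {x y : Fin t} → (toℕ x <ᵇ toℕ y) ≡ false → (toℕ y <ᵇ toℕ x) ≡ false → x ≡ y
  ≮ᵇ∧≯ᵇ⇒≡ x≮y y≮x =
    toℕ-injective (≤-antisym (≮⇒≥ (λ y<x → subst T y≮x (<⇒<ᵇ y<x))) (≮⇒≥ (λ x<y → subst T x≮y (<⇒<ᵇ x<y))))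

  edge+edgeᵒᵖ≡adj : ∀ x y → 𝟙 (edge x y) + 𝟙 (edge y x) ≡ 𝟙 (adj x y)
  edge+edgeᵒᵖ≡adj x y with toℕ x <ᵇ toℕ y in x<y | toℕ y <ᵇ toℕ x in y<x
  ... | true  | true  =
    ⊥-elim (<-asym (<ᵇ⇒< (toℕ x) (toℕ y) (Equivalence.from T-≡ x<y)) (<ᵇ⇒< (toℕ y) (toℕ x) (Equivalence.from T-≡ y<x)))
  ... | true  | false = +-identityʳ _
  ... | false | true  = cong 𝟙 (adj-sym y x)
  ... | false | false with refl ← ≮ᵇ∧≯ᵇ⇒≡ {x} {y} x<y y<x = cong 𝟙 (sym (adj-irrefl x))

  m : ℕ
  m = sum (λ u → count (edge u))

  edgeCount≡m : edgeCount G ≡ m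
  edgeCount≡m = trans (foldr-+-tabulate (λ u → Subset.∣ nbr G u Subset.∩ above u ∣) id)
    (sum-cong-≗ {t} λ u → trans (∣W∣≡count (nbr G u Subset.∩ above u)) (count-cong λ v →
      trans (lookup-zipWith _∧_ v (nbr G u) (above u))
            (trans (cong (adj u v ∧_) (trans (lookup∘tabulate _ v) (if-then-true-else-false (toℕ u <ᵇ toℕ v)))) (∧-comm (adj u v) _))))
    where
    if-then-true-else-false : ∀ x → (if x then true else false) ≡ x
    if-then-true-else-false true  = refl
    if-then-true-else-false false = refl
    foldr-+-tabulate : ∀ {k} (f : Fin t → ℕ) (g : Fin k → Fin t) → foldr _+_ 0 (map f (tabulate g)) ≡ sum (f ∘ g)
    foldr-+-tabulate {zero}  f g = refl
    foldr-+-tabulate {suc k} f g = cong (f (g zero) +_) (foldr-+-tabulate f (g ∘ suc))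

  Δ : ℕ
  Δ = maxDegree G

  degree≤Δ : ∀ x → count (adj x) ≤ Δ
  degree≤Δ x = subst (_≤ Δ) (∣W∣≡count (nbr G x)) (≤-foldr-⊔-tabulate (degree G) id x)
    where
    ≤-foldr-⊔-tabulate : ∀ {k} (f : Fin t → ℕ) (g : Fin k → Fin t) i → f (g i) ≤ foldr _⊔_ 0 (map f (tabulate g))
    ≤-foldr-⊔-tabulate f g zero    = m≤m⊔n (f (g zero)) _
    ≤-foldr-⊔-tabulate f g (suc i) = ≤-trans (≤-foldr-⊔-tabulate f (g ∘ suc) i) (m≤n⊔m (f (g zero)) _)

  -- Every edge meeting V is counted at one of its endpoints in V, each of degree at most Δ.
  edges-meeting≤ : ∀ (V : Fin t → Bool) →
    sum (λ u → sum (λ v → 𝟙 (V u) * 𝟙 (edge u v) + 𝟙 (V v) * 𝟙 (edge u v))) ≤ count V * Δ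
  edges-meeting≤ V = begin
    sum (λ u → sum (λ v → 𝟙 (V u) * 𝟙 (edge u v) + 𝟙 (V v) * 𝟙 (edge u v)))
      ≡⟨ trans (sum-cong-≗ {t} (λ u → ∑-distrib-+ {t} _ _)) (∑-distrib-+ {t} _ _) ⟩
    sum (λ u → sum (λ v → 𝟙 (V u) * 𝟙 (edge u v))) + sum (λ u → sum (λ v → 𝟙 (V v) * 𝟙 (edge u v)))
      ≡⟨ cong (sum (λ u → sum (λ v → 𝟙 (V u) * 𝟙 (edge u v))) +_) (∑-comm {t} {t} (λ u v → 𝟙 (V v) * 𝟙 (edge u v))) ⟩
    sum (λ x → sum (λ y → 𝟙 (V x) * 𝟙 (edge x y))) + sum (λ x → sum (λ y → 𝟙 (V x) * 𝟙 (edge y x)))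
      ≡⟨ trans (sym (∑-distrib-+ {t} _ _)) (sum-cong-≗ {t} (λ x → sym (∑-distrib-+ {t} _ _))) ⟩
    sum (λ x → sum (λ y → 𝟙 (V x) * 𝟙 (edge x y) + 𝟙 (V x) * 𝟙 (edge y x)))
      ≡⟨ sum-cong-≗ {t} (λ x → sum-cong-≗ {t} (λ y →
           trans (sym (*-distribˡ-+ (𝟙 (V x)) _ _)) (cong (𝟙 (V x) *_) (edge+edgeᵒᵖ≡adj x y)))) ⟩
    sum (λ x → sum (λ y → 𝟙 (V x) * 𝟙 (adj x y)))
      ≡⟨ sum-cong-≗ {t} (λ x → sym (*-distribˡ-sum (𝟙 (V x)) (𝟙 ∘ adj x))) ⟩
    sum (λ x → 𝟙 (V x) * count (adj x))
      ≤⟨ sum-mono-≤ (λ x → *-monoʳ-≤ (𝟙 (V x)) (degree≤Δ x)) ⟩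
    sum (λ x → 𝟙 (V x) * Δ)
      ≡⟨ *-distribʳ-sum Δ (𝟙 ∘ V) ⟨
    count V * Δ ∎
    where open ≤-Reasoning

  m≤edges-avoiding+|V|Δ : ∀ (V : Fin t → Bool) →
    m ≤ sum (λ u → count (λ v → edge u v ∧ (not (V u) ∧ not (V v)))) + count V * Δ
  m≤edges-avoiding+|V|Δ V = begin
    m ≤⟨ sum-mono-≤ (λ u → sum-mono-≤ (λ v → split (edge u v) (V u) (V v))) ⟩
    sum (λ u → sum (λ v → 𝟙 (edge u v ∧ (not (V u) ∧ not (V v))) + (𝟙 (V u) * 𝟙 (edge u v) + 𝟙 (V v) * 𝟙 (edge u v))))
      ≡⟨ trans (sum-cong-≗ {t} (λ u → ∑-distrib-+ {t} _ _)) (∑-distrib-+ {t} _ _) ⟩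
    sum (λ u → count (λ v → edge u v ∧ (not (V u) ∧ not (V v))))
      + sum (λ u → sum (λ v → 𝟙 (V u) * 𝟙 (edge u v) + 𝟙 (V v) * 𝟙 (edge u v)))
      ≤⟨ +-monoʳ-≤ _ (edges-meeting≤ V) ⟩
    sum (λ u → count (λ v → edge u v ∧ (not (V u) ∧ not (V v)))) + count V * Δ ∎
    where
    open ≤-Reasoning
    split : ∀ e x y → 𝟙 e ≤ 𝟙 (e ∧ (not x ∧ not y)) + (𝟙 x * 𝟙 e + 𝟙 y * 𝟙 e)
    split false x     y     = z≤n
    split true  true  y     = s≤s z≤n
    split true  false true  = s≤s z≤n
    split true  false false = s≤s z≤n

module CoveringEvents {t : ℕ} (G : Graph t) (w : ℕ) where
  open import Data.Nat using (ℕ; zero; suc; _+_; _*_; _∸_; _≤_; _≡ᵇ_; z≤n)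
  open import Data.Nat.Combinatorics using (_C_)
  open import Data.Nat.Properties
  open import Data.Bool using (Bool; true; false; _∧_; _∨_; not)
  open import Data.Bool.Properties using (T-≡; ∧-identityʳ; ∧-assoc; ∨-zeroʳ; not-involutive)
  open import Data.Fin using (Fin; zero; suc)
  open import Data.Fin.Subset using (Subset; ∣_∣)
  open import Data.Vec using (lookup)
  open import Data.List using (List; length; filterᵇ; cartesianProduct; allFin) renaming (lookup to lookupᴸ)
  open import Data.List.Membership.Propositional using (_∈_)
  open import Data.List.Membership.Propositional.Properties using (∈-filter⁺; ∈-cartesianProduct⁺; ∈-allFin; ∈-lookup)
  open import Data.List.Relation.Unary.All using (All)
  import Data.List.Relation.Unary.All as All
  open import Data.List.Relation.Unary.All.Properties using (all-filter)
  open import Data.List.Relation.Unary.Any using (index)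
  open import Data.List.Relation.Unary.Any.Properties using (lookup-index)
  open import Data.Product using (∃; _×_; _,_; proj₁; proj₂)
  open import Function using (_∘_)
  open import Function.Bundles using (Equivalence)
  open import Relation.Binary.PropositionalEquality
  open import Relation.Nullary.Decidable using (T?)
  open Counting
  open Subsets
  open GraphCounting G

  -- The event (u , v , W): no covering set contains u and v but avoids W.
  Event : Set
  Event = Fin t × Fin t × Subset t

  ends : Fin t → Fin t → Fin t → Bool
  ends u v x = (u == x) ∨ (v == x)

  valid : Event → Bool
  valid (u , v , W) = edge u v ∧ ((∣ W ∣ ≡ᵇ w) ∧ disjointᵇ W (ends u v))

  triples : List Event
  triples = cartesianProduct (allFin t) (cartesianProduct (allFin t) (allSubsets t))

  events : List Event
  events = filterᵇ valid triples

  E : ℕ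
  E = length events

  event : Fin E → Event
  event = lookupᴸ events

  valid-event : ∀ k → valid (event k) ≡ true
  valid-event k = Equivalence.to T-≡ (All.lookup (all-filter (T? ∘ valid) triples) (∈-lookup k))

  valid⇒event : ∀ e → valid e ≡ true → ∃ λ k → event k ≡ e
  valid⇒event e@(u , v , W) e-valid = index e∈events , sym (lookup-index e∈events)
    where
    e∈events : e ∈ events
    e∈events = ∈-filter⁺ (T? ∘ valid)
      (∈-cartesianProduct⁺ (∈-allFin u) (∈-cartesianProduct⁺ (∈-allFin v) (∈-allSubsets W)))
      (Equivalence.from T-≡ e-valid)

  countᴸ-events : ∀ (f : Event → Bool) → countᴸ f events ≡
    sum (λ u → sum (λ v → countᴸ (λ W → valid (u , v , W) ∧ f (u , v , W)) (allSubsets t)))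
  countᴸ-events f = trans (countᴸ-filterᵇ f valid triples)
    (trans (countᴸ-cartesianProduct (λ e → valid e ∧ f e) (cartesianProduct (allFin t) (allSubsets t)))
           (sum-cong-≗ {t} (λ u → countᴸ-cartesianProduct (λ e → valid (u , e) ∧ f (u , e)) (allSubsets t))))

  valid⇒ : ∀ u v W → valid (u , v , W) ≡ true →
    edge u v ≡ true × ∣ W ∣ ≡ w × disjointᵇ W (ends u v) ≡ true
  valid⇒ u v W e-valid with edge u v | ∣ W ∣ ≡ᵇ w in ∣W∣≡ᵇw | disjointᵇ W (ends u v)
  ... | true | true | true = refl , ≡ᵇ⇒≡ ∣ W ∣ w (Equivalence.from T-≡ ∣W∣≡ᵇw) , refl

  vertices : Event → Fin t → Bool
  vertices (u , v , W) x = (lookup W x ∨ (u == x)) ∨ (v == x)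

  count-ends : ∀ {u v} → u ≢ v → count (ends u v) ≡ 2
  count-ends {u} {v} u≢v = trans (count-insert (u ==_) (≢⇒==false u≢v)) (cong suc (count-== u))

  count-vertices : ∀ e → valid e ≡ true → count (vertices e) ≡ 2 + w
  count-vertices (u , v , W) e-valid = begin
    count (λ x → (lookup W x ∨ (u == x)) ∨ (v == x))   ≡⟨ count-insert (λ x → lookup W x ∨ (u == x)) v∉W∪u ⟩
    suc (count (λ x → lookup W x ∨ (u == x)))          ≡⟨ cong suc (count-insert (lookup W) (W∌ {u} u==u)) ⟩
    suc (suc (count (lookup W)))                       ≡⟨ cong (2 +_) (sym (∣W∣≡count W)) ⟩
    suc (suc ∣ W ∣)                                    ≡⟨ cong (2 +_) ∣W∣≡w ⟩
    2 + w                                              ∎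
    where
    open ≡-Reasoning
    uv : edge u v ≡ true
    uv = proj₁ (valid⇒ u v W e-valid)
    ∣W∣≡w : ∣ W ∣ ≡ w
    ∣W∣≡w = proj₁ (proj₂ (valid⇒ u v W e-valid))
    W∌ : ∀ {x} → ends u v x ≡ true → lookup W x ≡ false
    W∌ = disjointᵇ⇒∉ {W = W} (ends u v) (proj₂ (proj₂ (valid⇒ u v W e-valid)))
    u==u : ends u v u ≡ true
    u==u rewrite ==-refl u = refl
    v==v : ends u v v ≡ true
    v==v rewrite ==-refl v = ∨-zeroʳ _
    v∉W∪u : (lookup W v ∨ (u == v)) ≡ false
    v∉W∪u rewrite W∌ {v} v==v = ≢⇒==false (edge⇒≢ {u} {v} uv)

  C₂ C₄ : ℕ
  C₂ = (t ∸ 2) C w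
  C₄ = (t ∸ (w + 4)) C w

  countᴸ-valid : ∀ u v (f : Subset t → Bool) →
    countᴸ (λ W → valid (u , v , W) ∧ f W) (allSubsets t)
      ≡ 𝟙 (edge u v) * countᴸ (λ W → ((∣ W ∣ ≡ᵇ w) ∧ disjointᵇ W (ends u v)) ∧ f W) (allSubsets t)
  countᴸ-valid u v f with edge u v
  ... | true  = sym (+-identityʳ _)
  ... | false = countᴸ-false (allSubsets t)

  𝟙edge*-cong : ∀ {u v x y} → (edge u v ≡ true → x ≡ y) → 𝟙 (edge u v) * x ≡ 𝟙 (edge u v) * y
  𝟙edge*-cong {u} {v} x≡y with edge u v
  ... | true  = cong (1 *_) (x≡y refl)
  ... | false = refl

  E≡m*C₂ : E ≡ m * C₂
  E≡m*C₂ = begin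
    E                                        ≡⟨ count-true E ⟨
    count (λ (_ : Fin E) → true)             ≡⟨ count-lookup (λ _ → true) events ⟩
    countᴸ (λ _ → true) events               ≡⟨ countᴸ-events (λ _ → true) ⟩
    sum (λ u → sum (λ v → countᴸ (λ W → valid (u , v , W) ∧ true) (allSubsets t)))
      ≡⟨ sum-cong-≗ {t} (λ u → sum-cong-≗ {t} (λ v →
           trans (countᴸ-valid u v (λ _ → true)) (𝟙edge*-cong {u} {v} (w-subsets u v)))) ⟩
    sum (λ u → sum (λ v → 𝟙 (edge u v) * C₂)) ≡⟨ sum-cong-≗ {t} (λ u → *-distribʳ-sum C₂ (𝟙 ∘ edge u)) ⟨
    sum (λ u → count (edge u) * C₂)          ≡⟨ *-distribʳ-sum C₂ (λ u → count (edge u)) ⟨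
    m * C₂                                   ∎
    where
    open ≡-Reasoning
    w-subsets : ∀ u v → edge u v ≡ true →
      countᴸ (λ W → ((∣ W ∣ ≡ᵇ w) ∧ disjointᵇ W (ends u v)) ∧ true) (allSubsets t) ≡ C₂
    w-subsets u v uv = begin
      countᴸ (λ W → ((∣ W ∣ ≡ᵇ w) ∧ disjointᵇ W (ends u v)) ∧ true) (allSubsets t)
        ≡⟨ countᴸ-cong (allSubsets t) (λ W → ∧-identityʳ _) ⟩
      countᴸ (λ W → (∣ W ∣ ≡ᵇ w) ∧ disjointᵇ W (ends u v)) (allSubsets t)
        ≡⟨ countᴸ-w-subsets t w (ends u v) ⟩
      (t ∸ count (ends u v)) C w
        ≡⟨ cong (λ k → (t ∸ k) C w) (count-ends (edge⇒≢ {u} {v} uv)) ⟩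
      C₂ ∎

  meets : (Fin t → Bool) → (Fin t → Bool) → Bool
  meets V V′ = not (every (λ x → not (V x ∧ V′ x)))

  Dep : Fin E → Fin E → Bool
  Dep i k = meets (vertices (event i)) (vertices (event k))

  u∈vertices : ∀ u v W → vertices (u , v , W) u ≡ true
  u∈vertices u v W rewrite ==-refl u | ∨-zeroʳ (lookup W u) = refl

  Dep-refl : ∀ i → Dep i i ≡ true
  Dep-refl i with event i
  ... | (u , v , W) = cong not (false⇒¬every u (cong not (cong (λ b → b ∧ b) (u∈vertices u v W))))

  -- Pointwise form of: for u, v ∉ V, W misses {u, v} and V misses W ∪ {u, v} iff W misses V ∪ {u, v}.
  avoid-merge : ∀ Wx eu ev Vx → (eu ≡ true → Vx ≡ false) → (ev ≡ true → Vx ≡ false) →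
    (not (Wx ∧ (eu ∨ ev)) ∧ not (Vx ∧ ((Wx ∨ eu) ∨ ev))) ≡ not (Wx ∧ ((Vx ∨ eu) ∨ ev))
  avoid-merge Wx    eu    ev    false _  _  = ∧-identityʳ _
  avoid-merge true  false false true  _  _  = refl
  avoid-merge false false false true  _  _  = refl
  avoid-merge Wx    true  ev    true  eu _  with eu refl
  ... | ()
  avoid-merge Wx    false true  true  _  ev with ev refl
  ... | ()

  valid∧independent : ∀ (V : Fin t → Bool) u v W → edge u v ≡ true → V u ≡ false → V v ≡ false →
    (valid (u , v , W) ∧ not (meets V (vertices (u , v , W))))
      ≡ ((∣ W ∣ ≡ᵇ w) ∧ disjointᵇ W (λ x → (V x ∨ (u == x)) ∨ (v == x)))
  valid∧independent V u v W uv Vu Vv rewrite uv = begin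
    ((∣ W ∣ ≡ᵇ w) ∧ disjointᵇ W (ends u v)) ∧ not (not (every V∩Vₑ=∅))
      ≡⟨ cong (((∣ W ∣ ≡ᵇ w) ∧ disjointᵇ W (ends u v)) ∧_) (not-involutive _) ⟩
    ((∣ W ∣ ≡ᵇ w) ∧ disjointᵇ W (ends u v)) ∧ every V∩Vₑ=∅
      ≡⟨ ∧-assoc (∣ W ∣ ≡ᵇ w) _ _ ⟩
    (∣ W ∣ ≡ᵇ w) ∧ (disjointᵇ W (ends u v) ∧ every V∩Vₑ=∅)
      ≡⟨ cong ((∣ W ∣ ≡ᵇ w) ∧_) (sym (every-∧ _ V∩Vₑ=∅)) ⟩
    (∣ W ∣ ≡ᵇ w) ∧ every (λ x → not (lookup W x ∧ ends u v x) ∧ V∩Vₑ=∅ x)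
      ≡⟨ cong ((∣ W ∣ ≡ᵇ w) ∧_) (every-cong (λ x → avoid-merge (lookup W x) (u == x) (v == x) (V x)
           (λ u==x → subst (λ y → V y ≡ false) (==⇒≡ u==x) Vu) (λ v==x → subst (λ y → V y ≡ false) (==⇒≡ v==x) Vv))) ⟩
    (∣ W ∣ ≡ᵇ w) ∧ disjointᵇ W (λ x → (V x ∨ (u == x)) ∨ (v == x)) ∎
    where
    open ≡-Reasoning
    V∩Vₑ=∅ : Fin t → Bool
    V∩Vₑ=∅ x = not (V x ∧ vertices (u , v , W) x)

  count-V∪ends : ∀ (V : Fin t → Bool) u v → edge u v ≡ true → V u ≡ false → V v ≡ false →
    count (λ x → (V x ∨ (u == x)) ∨ (v == x)) ≡ 2 + count V
  count-V∪ends V u v uv Vu Vv = begin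
    count (λ x → (V x ∨ (u == x)) ∨ (v == x))
      ≡⟨ count-insert (λ x → V x ∨ (u == x)) (trans (cong (V v ∨_) (≢⇒==false (edge⇒≢ {u} {v} uv))) (cong (_∨ false) Vv)) ⟩
    suc (count (λ x → V x ∨ (u == x)))  ≡⟨ cong suc (count-insert V Vu) ⟩
    2 + count V                         ∎
    where open ≡-Reasoning

  countᴸ-independent : ∀ (V : Fin t → Bool) u v → edge u v ≡ true → V u ≡ false → V v ≡ false →
    countᴸ (λ W → valid (u , v , W) ∧ not (meets V (vertices (u , v , W)))) (allSubsets t) ≡ (t ∸ (2 + count V)) C w
  countᴸ-independent V u v uv Vu Vv = begin
    countᴸ (λ W → valid (u , v , W) ∧ not (meets V (vertices (u , v , W)))) (allSubsets t)
      ≡⟨ countᴸ-cong (allSubsets t) (λ W → valid∧independent V u v W uv Vu Vv) ⟩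
    countᴸ (λ W → (∣ W ∣ ≡ᵇ w) ∧ disjointᵇ W (λ x → (V x ∨ (u == x)) ∨ (v == x))) (allSubsets t)
      ≡⟨ countᴸ-w-subsets t w (λ x → (V x ∨ (u == x)) ∨ (v == x)) ⟩
    (t ∸ count (λ x → (V x ∨ (u == x)) ∨ (v == x))) C w
      ≡⟨ cong (λ k → (t ∸ k) C w) (count-V∪ends V u v uv Vu Vv) ⟩
    (t ∸ (2 + count V)) C w ∎
    where open ≡-Reasoning

  count-independent≥ : ∀ i → let V = vertices (event i) in
    sum (λ u → count (λ v → edge u v ∧ (not (V u) ∧ not (V v)))) * C₄ ≤ count (λ k → not (Dep i k))
  count-independent≥ i = begin
    sum (λ u → count (λ v → edge u v ∧ (not (V u) ∧ not (V v)))) * C₄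
      ≡⟨ *-distribʳ-sum C₄ (λ u → count (λ v → edge u v ∧ (not (V u) ∧ not (V v)))) ⟩
    sum (λ u → count (λ v → edge u v ∧ (not (V u) ∧ not (V v))) * C₄)
      ≡⟨ sum-cong-≗ {t} (λ u → *-distribʳ-sum C₄ (λ v → 𝟙 (edge u v ∧ (not (V u) ∧ not (V v))))) ⟩
    sum (λ u → sum (λ v → 𝟙 (edge u v ∧ (not (V u) ∧ not (V v))) * C₄))
      ≤⟨ sum-mono-≤ (λ u → sum-mono-≤ (λ v → per-edge u v (edge u v) refl (V u) refl (V v) refl)) ⟩
    sum (λ u → sum (λ v → countᴸ (λ W → valid (u , v , W) ∧ independent (u , v , W)) (allSubsets t)))
      ≡⟨ countᴸ-events independent ⟨
    countᴸ independent events
      ≡⟨ count-lookup independent events ⟨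
    count (λ k → not (Dep i k)) ∎
    where
    open ≤-Reasoning
    V = vertices (event i)
    independent : Event → Bool
    independent e = not (meets V (vertices e))
    per-edge : ∀ u v → ∀ e → edge u v ≡ e → ∀ x → V u ≡ x → ∀ y → V v ≡ y →
      𝟙 (e ∧ (not x ∧ not y)) * C₄ ≤ countᴸ (λ W → valid (u , v , W) ∧ independent (u , v , W)) (allSubsets t)
    per-edge u v false _  _     _  _     _  = z≤n
    per-edge u v true  _  true  _  _     _  = z≤n
    per-edge u v true  _  false _  true  _  = z≤n
    per-edge u v true  uv false Vu false Vv = ≤-reflexive (sym (begin-equality
      countᴸ (λ W → valid (u , v , W) ∧ independent (u , v , W)) (allSubsets t)
        ≡⟨ countᴸ-independent V u v uv Vu Vv ⟩
      (t ∸ (2 + count V)) C w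
        ≡⟨ cong (λ k → (t ∸ (2 + k)) C w) (count-vertices (event i) (valid-event i)) ⟩
      (t ∸ (2 + (2 + w))) C w
        ≡⟨ cong (λ k → (t ∸ k) C w) (+-comm 4 w) ⟩
      C₄
        ≡⟨ +-identityʳ C₄ ⟨
      1 * C₄ ∎))

  count-Dep≤ : ∀ i → count (Dep i) + m * C₄ ≤ m * C₂ + (w + 2) * Δ * C₄
  count-Dep≤ i = begin
    count (Dep i) + m * C₄
      ≤⟨ +-monoʳ-≤ (count (Dep i)) (*-monoˡ-≤ C₄ (m≤edges-avoiding+|V|Δ V)) ⟩
    count (Dep i) + (m′ + count V * Δ) * C₄
      ≡⟨ cong (count (Dep i) +_) (*-distribʳ-+ C₄ m′ (count V * Δ)) ⟩
    count (Dep i) + (m′ * C₄ + count V * Δ * C₄)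
      ≤⟨ +-monoʳ-≤ (count (Dep i)) (+-monoˡ-≤ (count V * Δ * C₄) (count-independent≥ i)) ⟩
    count (Dep i) + (count (λ k → not (Dep i k)) + count V * Δ * C₄)
      ≡⟨ +-assoc (count (Dep i)) _ _ ⟨
    count (Dep i) + count (λ k → not (Dep i k)) + count V * Δ * C₄
      ≡⟨ cong₂ _+_ (trans (+-comm (count (Dep i)) _) (sym (count-split (λ _ → true) (Dep i))))
                   (cong (λ k → k * Δ * C₄) (trans (count-vertices (event i) (valid-event i)) (+-comm 2 w))) ⟩
    count (λ (_ : Fin E) → true) + (w + 2) * Δ * C₄
      ≡⟨ cong (_+ (w + 2) * Δ * C₄) (trans (count-true E) E≡m*C₂) ⟩
    m * C₂ + (w + 2) * Δ * C₄ ∎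
    where
    open ≤-Reasoning
    V = vertices (event i)
    m′ = sum (λ u → count (λ v → edge u v ∧ (not (V u) ∧ not (V v))))

  D : ℕ
  D = m * C₂ + (w + 2) * Δ * C₄ ∸ m * C₄

  count-Dep≤D : ∀ i → count (Dep i) ≤ D
  count-Dep≤D i = m+n≤o⇒m≤o∸n (count (Dep i)) (count-Dep≤ i)

module RandomCovering {t : ℕ} (G : Graph t) (w n a b : ℕ) .{{_ : NonZero b}} (a≤b : a Data.Nat.≤ b) where
  open import Data.Nat using (ℕ; zero; suc; _+_; _*_; _∸_; _^_; _≤_; _<_; _<ᵇ_; z≤n; s≤s; NonZero)
  open import Data.Nat.Properties
  open import Data.Integer using (+_)
  open import Data.Rational as ℚ using (1ℚ; toℚᵘ)
  import Data.Rational.Unnormalised as ℚᵘ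
  open import Data.Bool using (Bool; true; false; _∧_; _∨_; not; if_then_else_)
  open import Data.Bool.Properties using (T-≡; ∧-identityʳ; ∧-zeroʳ; ∨-zeroʳ; not-injective)
  open import Data.Fin using (Fin; zero; suc; toℕ; combine; remainder)
  open import Data.Fin.Properties using (remQuot-combine; toℕ-injective)
  open import Data.Fin.Subset using (Subset; ∣_∣; _∈_; _∉_; ⁅_⁆)
  open import Data.Fin.Subset.Properties using (x∈⁅y⁆⇒x≡y; ∣⁅x⁆∣≡1)
  open import Data.Vec using (lookup; tabulate)
  open import Data.Vec.Properties using (lookup⇒[]=; []=⇒lookup; lookup∘tabulate)
  open import Data.Product using (Σ; ∃; _×_; _,_; proj₁; proj₂; map₂)
  open import Data.Empty using (⊥; ⊥-elim)
  open import Function using (_∘_)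
  open import Function.Bundles using (Equivalence)
  open import Relation.Binary.Definitions using (tri<; tri≈; tri>)
  open import Relation.Binary.PropositionalEquality
  open import Algebra.Properties.CommutativeSemigroup *-commutativeSemigroup using (interchange; x∙yz≈y∙xz)
  open Counting
  open Fractions using (frac)
  open Quantities using (e*-hypothesis⇒; DOf≡)
  open ProductSpace b
  open GraphCounting G
  open CoveringEvents G w
  open Subsets using (∣W∣≡count; disjointᵇ⇒∉)

  N : ℕ
  N = n * t

  -- Vertex x is put into the j-th set iff the coordinate combine j x is below a; this has probability a/b.
  below : Fin b → Bool
  below c = toℕ c <ᵇ a

  count-below : count below ≡ a
  count-below = go b a≤b
    where
    go : ∀ k {a} → a ≤ k → count {k} (λ c → toℕ c <ᵇ a) ≡ a
    go zero    z≤n = refl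
    go (suc k) {zero}  z≤n = count-false (suc k)
    go (suc k) {suc a} (s≤s a≤k) = cong suc (go k a≤k)

  count-not-below : count (not ∘ below) ≡ b ∸ a
  count-not-below = begin
    count (not ∘ below)                              ≡⟨ m+n∸n≡m (count (not ∘ below)) (count below) ⟨
    count (not ∘ below) + count below ∸ count below  ≡⟨ cong₂ _∸_ (sym (count-split (λ _ → true) below)) count-below ⟩
    count (λ (_ : Fin b) → true) ∸ a                 ≡⟨ cong (_∸ a) (count-true b) ⟩
    b ∸ a                                            ∎
    where open ≡-Reasoning

  -- The condition on the colour c of vertex x for the set to cover the event (u , v , W).
  literal : Event → Fin t → Fin b → Bool
  literal (u , v , W) x c = if ends u v x then below c else if lookup W x then not (below c) else true

  covers : Event → Ω t → Bool
  covers e ξ = every (λ x → literal e x (lookup ξ x))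

  Bad : Event → Ω N → Bool
  Bad e ω = every (λ j → not (covers e (block {n} j ω)))

  literal-ends : ∀ u v W x c → ends u v x ≡ true → literal (u , v , W) x c ≡ below c
  literal-ends u v W x c x∈ends rewrite x∈ends = refl

  literal-W : ∀ u v W x c → ends u v x ≡ false → lookup W x ≡ true → literal (u , v , W) x c ≡ not (below c)
  literal-W u v W x c x∉ends x∈W rewrite x∉ends | x∈W = refl

  choices : Event → Fin t → ℕ
  choices (u , v , W) x = if ends u v x then a else if lookup W x then b ∸ a else b

  count-literal : ∀ e x → count (literal e x) ≡ choices e x
  count-literal (u , v , W) x with ends u v x | lookup W x
  ... | true  | _     = count-below
  ... | false | true  = count-not-below
  ... | false | false = count-true b

  B C : ℕ
  B = b ^ (2 + w)
  C = B ∸ a ^ 2 * (b ∸ a) ^ w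

  μ-covers : ∀ e → valid e ≡ true → μ (covers e) * B ≡ a ^ 2 * (b ∸ a) ^ w * b ^ t
  μ-covers e@(u , v , W) e-valid = begin
    μ (covers e) * B
      ≡⟨ cong (_* B) (trans (μ-coordinatewise (literal e)) (∏-cong (count-literal e))) ⟩
    ∏ (choices e) * b ^ (2 + w)
      ≡⟨ cong (λ k → ∏ (choices e) * b ^ k) (sym (cong₂ _+_ |ends| |W|)) ⟩
    ∏ (choices e) * b ^ (count (ends u v) + count (lookup W))
      ≡⟨ ∏-if (ends u v) (lookup W) a (b ∸ a) b ends∩W=∅ ⟩
    a ^ count (ends u v) * (b ∸ a) ^ count (lookup W) * b ^ t
      ≡⟨ cong₂ (λ k l → a ^ k * (b ∸ a) ^ l * b ^ t) |ends| |W| ⟩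
    a ^ 2 * (b ∸ a) ^ w * b ^ t ∎
    where
    open ≡-Reasoning
    |ends| : count (ends u v) ≡ 2
    |ends| = count-ends (edge⇒≢ {u} {v} (proj₁ (valid⇒ u v W e-valid)))
    |W| : count (lookup W) ≡ w
    |W| = trans (sym (∣W∣≡count W)) (proj₁ (proj₂ (valid⇒ u v W e-valid)))
    ends∩W=∅ : ∀ x → (ends u v x ∧ lookup W x) ≡ false
    ends∩W=∅ x with ends u v x in x∈ends
    ... | true  = disjointᵇ⇒∉ {W = W} (ends u v) (proj₂ (proj₂ (valid⇒ u v W e-valid))) x∈ends
    ... | false = refl

  [m*n]^k≡m^k*n^k : ∀ x y k → (x * y) ^ k ≡ x ^ k * y ^ k
  [m*n]^k≡m^k*n^k x y zero    = refl
  [m*n]^k≡m^k*n^k x y (suc k) = trans (cong (x * y *_) ([m*n]^k≡m^k*n^k x y k)) (interchange x y (x ^ k) (y ^ k))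

  -- Each of the n sets independently fails to cover e, with probability q = C / B.
  μ-Bad : ∀ e → valid e ≡ true → μ (Bad e) * B ^ n ≡ b ^ N * C ^ n
  μ-Bad e e-valid = begin
    μ (Bad e) * B ^ n             ≡⟨ cong (_* B ^ n) (μ-blocks n (not ∘ covers e)) ⟩
    μ̅ ^ n * B ^ n                ≡⟨ [m*n]^k≡m^k*n^k μ̅ B n ⟨
    (μ̅ * B) ^ n                  ≡⟨ cong (_^ n) μ̅*B ⟩
    (b ^ t * C) ^ n               ≡⟨ [m*n]^k≡m^k*n^k (b ^ t) C n ⟩
    (b ^ t) ^ n * C ^ n           ≡⟨ cong (_* C ^ n) (trans (^-*-assoc b t n) (cong (b ^_) (*-comm t n))) ⟩
    b ^ N * C ^ n                 ∎
    where
    open ≡-Reasoning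
    μ̅ = μ (not ∘ covers e)
    b^t≡ : b ^ t ≡ μ (covers e) + μ̅
    b^t≡ = trans (sym (μ-true t)) (μ-split (λ _ → true) (covers e))
    μ̅*B : μ̅ * B ≡ b ^ t * C
    μ̅*B = begin
      μ̅ * B                                        ≡⟨ cong (_* B) (m+n∸m≡n (μ (covers e)) μ̅) ⟨
      (μ (covers e) + μ̅ ∸ μ (covers e)) * B        ≡⟨ cong (λ k → (k ∸ μ (covers e)) * B) b^t≡ ⟨
      (b ^ t ∸ μ (covers e)) * B                    ≡⟨ *-distribʳ-∸ B (b ^ t) (μ (covers e)) ⟩
      b ^ t * B ∸ μ (covers e) * B                  ≡⟨ cong (b ^ t * B ∸_) (trans (μ-covers e e-valid) (*-comm _ (b ^ t))) ⟩
      b ^ t * B ∸ b ^ t * (a ^ 2 * (b ∸ a) ^ w)     ≡⟨ *-distribˡ-∸ (b ^ t) B _ ⟨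
      b ^ t * C                                     ∎

  vertex : Fin N → Fin t
  vertex = remainder {n} t

  literal-outside : ∀ e x c → vertices e x ≡ false → literal e x c ≡ true
  literal-outside (u , v , W) x c x∉e with lookup W x | u == x | v == x
  literal-outside (u , v , W) x c refl | false | false | false = refl

  Bad-depends : ∀ e → DependsOn (λ i → vertices e (vertex i)) (Bad e)
  Bad-depends e ω ω′ agree = every-cong (λ j → cong not (every-cong (same-literal j)))
    where
    same-literal : ∀ j x → literal e x (lookup (block {n} j ω) x) ≡ literal e x (lookup (block j ω′) x)
    same-literal j x with vertices e x in x∈e
    ... | false = trans (literal-outside e x _ x∈e) (sym (literal-outside e x _ x∈e))
    ... | true  = cong (literal e x) (begin
      lookup (block j ω) x    ≡⟨ lookup-block j ω x ⟩
      lookup ω (combine j x)  ≡⟨ agree (combine j x) (trans (cong (vertices e ∘ proj₂) (remQuot-combine j x)) x∈e) ⟩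
      lookup ω′ (combine j x) ≡⟨ lookup-block j ω′ x ⟨
      lookup (block j ω′) x   ∎)
      where open ≡-Reasoning

  open LovaszLocalLemma (productMeasure N)

  meets≡false⇒ : ∀ {V V′ : Fin t → Bool} → meets V V′ ≡ false → ∀ {x} → V′ x ≡ true → V x ≡ false
  meets≡false⇒ {V} {V′} V∩V′=∅ {x} x∈V′ with every⇒ (not-injective V∩V′=∅) x
  ... | ¬x∈V∩V′ rewrite x∈V′ = trans (sym (∧-identityʳ (V x))) (not-injective ¬x∈V∩V′)

  Bad-independent : ∀ i S → (∀ k → S k ≡ true → Dep i k ≡ false) →
    μ {N} (λ _ → true) * μ (λ ω → Bad (event i) ω ∧ Avoid (Bad ∘ event) S ω) ≡ μ (Bad (event i)) * μ (Avoid (Bad ∘ event) S)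
  Bad-independent i S S∩Depᵢ=∅ =
    trans (cong (_* μ (λ ω → Bad (event i) ω ∧ Avoid (Bad ∘ event) S ω)) (μ-true N))
          (μ-independent Vᵢ (Bad-depends (event i)) avoid-depends)
    where
    Vᵢ : Fin N → Bool
    Vᵢ c = vertices (event i) (vertex c)
    avoid-depends : DependsOn (not ∘ Vᵢ) (Avoid (Bad ∘ event) S)
    avoid-depends ω ω′ agree = every-cong same
      where
      same : ∀ k → not (S k ∧ Bad (event k) ω) ≡ not (S k ∧ Bad (event k) ω′)
      same k with S k in k∈S
      ... | false = refl
      ... | true  = cong not (Bad-depends (event k) ω ω′ λ c c∈Vₖ →
                      agree c (cong not (meets≡false⇒ {vertices (event i)} {vertices (event k)} (S∩Depᵢ=∅ k k∈S) c∈Vₖ)))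

  true≢false : ∀ {β} → β ≡ true → β ≡ false → ⊥
  true≢false refl ()

  covering-family : Ω N → Fin n → Subset t
  covering-family ω j = tabulate (λ x → below (lookup ω (combine j x)))

  ∉⇒lookup≡false : ∀ {x} {W : Subset t} → x ∉ W → lookup W x ≡ false
  ∉⇒lookup≡false {x} {W} x∉W with lookup W x in Wx
  ... | true  = ⊥-elim (x∉W (lookup⇒[]= x W Wx))
  ... | false = refl

  ⇒valid : ∀ u v W → edge u v ≡ true → ∣ W ∣ ≡ w → u ∉ W → v ∉ W → valid (u , v , W) ≡ true
  ⇒valid u v W uv ∣W∣≡w u∉W v∉W rewrite uv | Equivalence.to T-≡ (≡⇒≡ᵇ ∣ W ∣ w ∣W∣≡w) = ⇒every avoids
    where
    avoids : ∀ x → not (lookup W x ∧ ends u v x) ≡ true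
    avoids x with u == x in u==x | v == x in v==x
    ... | true  | _    rewrite sym (==⇒≡ {i = u} {x} u==x) | ∉⇒lookup≡false u∉W = refl
    ... | false | true rewrite sym (==⇒≡ {i = v} {x} v==x) | ∉⇒lookup≡false v∉W = refl
    ... | false | false rewrite ∧-zeroʳ (lookup W x) = refl

  covers⇒ : ∀ ω j u v W → lookup W u ≡ false → lookup W v ≡ false → covers (u , v , W) (block j ω) ≡ true →
    let A = covering-family ω j in u ∈ A × v ∈ A × (∀ x → x ∈ W → x ∉ A)
  covers⇒ ω j u v W u∉W v∉W covered = ends⊆A (u==u) , ends⊆A v==v , W∩A=∅
    where
    A : Subset t
    A = covering-family ω j
    ξ : Ω t
    ξ = block {n} j ω
    lookup-A : ∀ x → lookup A x ≡ below (lookup ξ x)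
    lookup-A x = trans (lookup∘tabulate _ x) (cong below (sym (lookup-block j ω x)))
    literal-holds : ∀ x → literal (u , v , W) x (lookup ξ x) ≡ true
    literal-holds = every⇒ covered
    u==u : ends u v u ≡ true
    u==u rewrite ==-refl u = refl
    v==v : ends u v v ≡ true
    v==v rewrite ==-refl v = ∨-zeroʳ (u == v)
    ends⊆A : ∀ {x} → ends u v x ≡ true → x ∈ A
    ends⊆A {x} x∈ends = lookup⇒[]= x A
      (trans (lookup-A x) (trans (sym (literal-ends u v W x _ x∈ends)) (literal-holds x)))
    W∩A=∅ : ∀ x → x ∈ W → x ∉ A
    W∩A=∅ x x∈W x∈A with ends u v x in x∈ends
    ... | true  = ⊥-elim (W∌ends x∈ends)
      where
      W∌ends : ends u v x ≡ true → ⊥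
      W∌ends x∈ends′ with u == x in u==x
      ... | true  rewrite ==⇒≡ {i = u} {x} u==x = true≢false ([]=⇒lookup x∈W) u∉W
      ... | false rewrite ==⇒≡ {i = v} {x} x∈ends′ = true≢false ([]=⇒lookup x∈W) v∉W
    ... | false = true≢false ([]=⇒lookup x∈A) (trans (lookup-A x) (not-injective
        (trans (sym (literal-W u v W x _ x∈ends ([]=⇒lookup x∈W))) (literal-holds x))))

  some-set-covers : ∀ ω → (∀ k → Bad (event k) ω ≡ false) →
    ∀ u v W → edge u v ≡ true → ∣ W ∣ ≡ w → u ∉ W → v ∉ W →
    ∃ λ j → let A = covering-family ω j in u ∈ A × v ∈ A × (∀ x → x ∈ W → x ∉ A)
  some-set-covers ω avoids u v W uv ∣W∣≡w u∉W v∉W =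
    j , covers⇒ ω j u v W (∉⇒lookup≡false u∉W) (∉⇒lookup≡false v∉W) (not-injective (proj₂ j-covers))
    where
    e-is-event : ∃ λ k → event k ≡ (u , v , W)
    e-is-event = valid⇒event (u , v , W) (⇒valid u v W uv ∣W∣≡w u∉W v∉W)
    j-covers : ∃ λ j → not (covers (u , v , W) (block j ω)) ≡ false
    j-covers = ¬every⇒∃ (subst (λ e → Bad e ω ≡ false) (proj₂ e-is-event) (avoids (proj₁ e-is-event)))
    j : Fin n
    j = proj₁ j-covers

  one-set-suffices : ∀ {ω u v W} → (∃ λ j → let A = covering-family ω j in u ∈ A × v ∈ A × (∀ x → x ∈ W → x ∉ A)) →
    Σ (Subset n) λ J → 1 ≤ ∣ J ∣ ×
      (∀ j → j ∈ J → let A = covering-family ω j in u ∈ A × v ∈ A × (∀ x → x ∈ W → x ∉ A))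
  one-set-suffices {ω} {u} {v} {W} (j , covered) = ⁅ j ⁆ , ≤-reflexive (sym (∣⁅x⁆∣≡1 j)) , λ j′ j′∈J →
    subst (λ i → let A = covering-family ω i in u ∈ A × v ∈ A × (∀ x → x ∈ W → x ∉ A))
          (sym (x∈⁅y⁆⇒x≡y j j′∈J)) covered

  avoids-all⇒covering : ∀ ω → (∀ k → Bad (event k) ω ≡ false) → IsCovering G w 1 (covering-family ω)
  avoids-all⇒covering ω avoids u v uv W ∣W∣≡w u∉W v∉W with <-cmp (toℕ u) (toℕ v)
  ... | tri< u<v _ _ = one-set-suffices {ω} (some-set-covers ω avoids u v W (<⇒edge u<v ([]=⇒lookup uv)) ∣W∣≡w u∉W v∉W)
  ... | tri> _ _ v<u = one-set-suffices {ω} (map₂ (λ (v∈A , u∈A , W∩A=∅) → u∈A , v∈A , W∩A=∅)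
        (some-set-covers ω avoids v u W (<⇒edge v<u ([]=⇒lookup (symmetric G uv))) ∣W∣≡w v∉W u∉W))
  ... | tri≈ _ u≡v _ with refl ← toℕ-injective u≡v = ⊥-elim (irrefl G uv)

  covering-exists : ∀ d → (∀ i → count (Dep i) ≤ d) → suc d ^ suc d * C ^ n ≤ d ^ d * B ^ n → N≤ G w 1 n
  covering-exists d |Dep|≤d bound = n , ≤-refl , covering-family ω , avoids-all⇒covering ω avoids
    where
    μBad≤ : ∀ i → suc d ^ suc d * μ (Bad (event i)) ≤ μ {N} (λ _ → true) * d ^ d
    μBad≤ i = *-cancelʳ-≤ _ _ (B ^ n) {{m^n≢0 B n {{m^n≢0 b (2 + w)}}}} (begin
      suc d ^ suc d * μ (Bad (event i)) * B ^ n    ≡⟨ *-assoc (suc d ^ suc d) _ _ ⟩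
      suc d ^ suc d * (μ (Bad (event i)) * B ^ n)  ≡⟨ cong (suc d ^ suc d *_) (μ-Bad (event i) (valid-event i)) ⟩
      suc d ^ suc d * (b ^ N * C ^ n)              ≡⟨ x∙yz≈y∙xz (suc d ^ suc d) (b ^ N) (C ^ n) ⟩
      b ^ N * (suc d ^ suc d * C ^ n)              ≤⟨ *-monoʳ-≤ (b ^ N) bound ⟩
      b ^ N * (d ^ d * B ^ n)                      ≡⟨ *-assoc (b ^ N) (d ^ d) (B ^ n) ⟨
      b ^ N * d ^ d * B ^ n                        ≡⟨ cong (λ k → k * d ^ d * B ^ n) (μ-true N) ⟨
      μ {N} (λ _ → true) * d ^ d * B ^ n           ∎)
      where open ≤-Reasoning
    μ⊤>0 : 0 < μ {N} (λ _ → true)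
    μ⊤>0 = subst (0 <_) (sym (μ-true N)) (m^n>0 b N)
    witness : ∃ λ ω → ∀ k → Bad (event k) ω ≡ false
    witness = lovasz-local-lemma (Bad ∘ event) Dep d Dep-refl |Dep|≤d Bad-independent μBad≤ μ⊤>0
    ω : Ω N
    ω = proj₁ witness
    avoids : ∀ k → Bad (event k) ω ≡ false
    avoids = proj₂ witness

  covering-from-e*-bound : ∀ p → toℚᵘ p ℚᵘ.≃ frac a b →
    e* ((ℤtoℚ (DOf t (edgeCount G) (maxDegree G) w) ℚ.+ 1ℚ) ℚ.* (qOf p w ^ℚ n)) ≤1 → N≤ G w 1 n
  covering-from-e*-bound p p≃a/b hyp = covering-exists D count-Dep≤D (e*-hypothesis⇒ p a b w a≤b p≃a/b n D hyp′)
    where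
    DOf≡D : DOf t (edgeCount G) (maxDegree G) w ≡ + D
    DOf≡D = trans (cong (λ m′ → DOf t m′ (maxDegree G) w) edgeCount≡m) (DOf≡ t m (maxDegree G) w)
    hyp′ : e* ((ℤtoℚ (+ D) ℚ.+ 1ℚ) ℚ.* (qOf p w ^ℚ n)) ≤1
    hyp′ = subst (λ D′ → e* ((ℤtoℚ D′ ℚ.+ 1ℚ) ℚ.* (qOf p w ^ℚ n)) ≤1) DOf≡D hyp


open Quantities using (<1⇒numerator≤denominator)
open import Data.Integer using (+_; -[1+_])
open import Data.Rational using (ℚ; mkℚ; 0ℚ; 1ℚ; _<_; _*_; _+_)
import Data.Rational.Properties as ℚ
import Data.Rational.Unnormalised.Properties as ℚᵘ

theorem3p12 : ∀ {t} (G : Graph t) (w : ℕ) → .{{NonZero w}} →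
    (p : ℚ) → 0ℚ < p → p < 1ℚ →
    ∀ (n : ℕ) →
    e* ((ℤtoℚ (DOf t (edgeCount G) (maxDegree G) w) + 1ℚ) * (qOf p w ^ℚ n)) ≤1 →
    N≤ G w 1 n
theorem3p12 G w p@(mkℚ (+ a) b′ _) _ p<1 n =
  RandomCovering.covering-from-e*-bound G w n a (suc b′) (<1⇒numerator≤denominator p<1) p ℚᵘ.≃-refl
theorem3p12 G w (mkℚ -[1+ _ ] _ _) 0<p with ℚ.drop-*<* 0<p
... | ()
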